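{- Let $H$ be a graph whose independence polynomial $I(H;x)$ has only real roots, and let $p\geq 2$. Define $G_1=H\circ K_p$ and $G_{j+1}=G_j\circ K_p$ for $j\geq 1$. Then every graph $G\in\{G_1,G_2,G_3,\dots\}$ is $1$-well-covered, and its independence polynomial $I(G;x)$ has all its roots real and hence is unimodal.
   Context: All graphs are finite and simple with nonempty vertex set. The independence polynomial of a graph $G$ is $I(G;x)=\sum_{k=0}^{\alpha(G)} s_kx^k$, where $s_k$ is the number of independent sets (sets of pairwise non-adjacent vertices) of size $k$ and $\alpha(G)$ is the maximum size of an independent set. The corona $G\circ K_p$ is obtained from $G$ by taking, for each vertex $v$ of $G$, a new disjoint copy of the complete graph $K_p$ and joining $v$ by edges to all vertices of that copy. A graph is well-covered if all its maximal independent sets have the same cardinality; $G$ is $1$-well-covered if it is well-covered, has at least two vertices, and $G-v$ is well-covered for every vertex $v$. A polynomial with coefficients $a_0,\dots,a_m$ is unimodal if there is $k$ with $a_0\leq\cdots\leq a_k\geq a_{k+1}\geq\cdots\geq a_m$. -}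

module Defs where

open import Level using (Level; _⊔_) renaming (suc to lsuc)
open import Data.Bool using (Bool; true; false; _∧_; not)
open import Data.Nat as ℕ using (ℕ; zero; suc; _≤_)
open import Data.Fin as Fin using (Fin; splitAt; remQuot; punchIn)
open import Data.Sum using (_⊎_; inj₁; inj₂)
open import Data.Product using (Σ; _×_; _,_; ∃)
open import Data.List as List using (List; []; _∷_; length; filterᵇ; allFin)
open import Data.Vec as Vec using (Vec; []; _∷_; lookup; _[_]≔_)
open import Data.Bool.ListAction using (and)
open import Data.Empty using (⊥)
open import Data.Unit using (⊤)
open import Relation.Nullary using (¬_; does)
open import Relation.Binary.Core using (Rel)
open import Relation.Binary.PropositionalEquality using (_≡_)
open import Algebra.Bundles using (CommutativeRing)

Graph : ℕ → Set
Graph n = Fin n → Fin n → Bool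

record IsSimpleGraph {n : ℕ} (G : Graph n) : Set where
  field
    nonempty    : 1 ≤ n
    symmetric   : ∀ u v → G u v ≡ G v u
    irreflexive : ∀ v → G v v ≡ false

VSet : ℕ → Set
VSet n = Vec Bool n

_∈ᵥ_ : {n : ℕ} → Fin n → VSet n → Set
v ∈ᵥ S = lookup S v ≡ true

card : {n : ℕ} → VSet n → ℕ
card [] = 0
card (true ∷ S) = suc (card S)
card (false ∷ S) = card S

Independent : {n : ℕ} → Graph n → VSet n → Set
Independent G S = ∀ u v → u ∈ᵥ S → v ∈ᵥ S → G u v ≡ false

independentᵇ : {n : ℕ} → Graph n → VSet n → Bool
independentᵇ {n} G S =
  and (List.map (λ u → and (List.map (λ v → not (lookup S u ∧ lookup S v ∧ G u v)) (allFin n))) (allFin n))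

MaximalIndependent : {n : ℕ} → Graph n → VSet n → Set
MaximalIndependent G S =
  Independent G S × (∀ v → ¬ (v ∈ᵥ S) → ¬ Independent G (S [ v ]≔ true))

WellCovered : {n : ℕ} → Graph n → Set
WellCovered {n} G =
  ∀ (S T : VSet n) → MaximalIndependent G S → MaximalIndependent G T → card S ≡ card T

deleteVertex : {n : ℕ} → Graph (suc n) → Fin (suc n) → Graph n
deleteVertex G v i j = G (punchIn v i) (punchIn v j)

OneWellCovered : {n : ℕ} → Graph n → Set
OneWellCovered {zero} G = ⊥
OneWellCovered {suc zero} G = ⊥
OneWellCovered {suc (suc n)} G = WellCovered G × (∀ v → WellCovered (deleteVertex G v))

allSubsets : (n : ℕ) → List (VSet n)
allSubsets zero = [] ∷ []
allSubsets (suc n) = List.map (true ∷_) (allSubsets n) List.++ List.map (false ∷_) (allSubsets n)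

-- s_k = number of independent sets of size k; these are the coefficients
-- of I(G;x) (s_k = 0 for k > α(G)).
indepCoeff : {n : ℕ} → Graph n → ℕ → ℕ
indepCoeff {n} G k =
  length (filterᵇ (λ S → independentᵇ G S ∧ does (card S ℕ.≟ k)) (allSubsets n))

-- Corona G ∘ K_p.  Vertices: Fin (n + n * p); the first n are the vertices
-- of G, the vertex n + j with remQuot {n} p j = (v , a) is the a-th vertex of
-- the copy of K_p attached to v.

corona : {n : ℕ} → (p : ℕ) → Graph n → Graph (n ℕ.+ n ℕ.* p)
corona {n} p G x y with splitAt n x | splitAt n y
... | inj₁ u | inj₁ v = G u v
... | inj₁ u | inj₂ j with remQuot {n} p j
...   | (v , _) = does (u Fin.≟ v)
corona {n} p G x y | inj₂ i | inj₁ v with remQuot {n} p i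
...   | (u , _) = does (u Fin.≟ v)
corona {n} p G x y | inj₂ i | inj₂ j with remQuot {n} p i | remQuot {n} p j
...   | (u , a) | (v , b) = does (u Fin.≟ v) ∧ not (does (a Fin.≟ b))

-- Iterated corona: coronaIter p 0 H = H, coronaIter p (j+1) H = (coronaIter p j H) ∘ K_p.
-- So G_j = coronaIter p j H for j ≥ 1.
coronaSize : ℕ → ℕ → ℕ → ℕ
coronaSize p n zero = n
coronaSize p n (suc j) = coronaSize p n j ℕ.+ coronaSize p n j ℕ.* p

coronaIter : {n : ℕ} → (p j : ℕ) → Graph n → Graph (coronaSize p n j)
coronaIter p zero H = H
coronaIter p (suc j) H = corona p (coronaIter p j H)

Unimodal : (ℕ → ℕ) → Set
Unimodal a = ∃ λ k → (∀ i → i ℕ.< k → a i ≤ a (suc i)) × (∀ i → k ≤ i → a (suc i) ≤ a i)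

-- Polynomials (coefficient lists, lowest degree first) over a commutative ring.

module Poly {c ℓ : Level} (R : CommutativeRing c ℓ) where
  open CommutativeRing R

  addP : List Carrier → List Carrier → List Carrier
  addP [] q = q
  addP (a ∷ p) [] = a ∷ p
  addP (a ∷ p) (b ∷ q) = (a + b) ∷ addP p q

  mulLin : Carrier → List Carrier → List Carrier
  mulLin r q = addP (0# ∷ q) (List.map (λ a → (- r) * a) q)

  prodLin : List Carrier → List Carrier
  prodLin [] = 1# ∷ []
  prodLin (r ∷ rs) = mulLin r (prodLin rs)

  coeff : List Carrier → ℕ → Carrier
  coeff [] k = 0#
  coeff (a ∷ p) zero = a
  coeff (a ∷ p) (suc k) = coeff p k

  eval : List Carrier → Carrier → Carrier
  eval [] x = 0#
  eval (a ∷ p) x = a + x * eval p x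

  pow : Carrier → ℕ → Carrier
  pow x zero = 1#
  pow x (suc k) = x * pow x k

  evalMonic : {d : ℕ} → Vec Carrier d → Carrier → Carrier
  evalMonic {d} cs x = pow x d + eval (Vec.toList cs) x

  fromℕ : ℕ → Carrier
  fromℕ zero = 0#
  fromℕ (suc k) = 1# + fromℕ k

-- Real closed fields: ordered fields in which every positive element is a
-- square and every odd-degree polynomial has a root.  (ℝ is one; by Tarski's
-- transfer principle, first-order facts such as "this integer polynomial
-- has only real roots" hold in ℝ iff they hold in every real closed field.)

record RealClosedField (c ℓ : Level) : Set (lsuc (c ⊔ ℓ)) where
  field
    commRing : CommutativeRing c ℓ
  open CommutativeRing commRing public
  open Poly commRing public
  field
    _<_         : Rel Carrier ℓ
  infix 4 _<_
  field
    nontrivial  : ¬ (0# ≈ 1#)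
    inverse     : ∀ x → ¬ (x ≈ 0#) → ∃ λ y → x * y ≈ 1#
    <-irrefl    : ∀ x → ¬ (x < x)
    <-trans     : ∀ {x y z} → x < y → y < z → x < z
    <-trichotomy : ∀ x y → x < y ⊎ (x ≈ y ⊎ y < x)
    <-respˡ-≈   : ∀ {x y z} → x ≈ y → x < z → y < z
    <-respʳ-≈   : ∀ {x y z} → x ≈ y → z < x → z < y
    +-mono-<    : ∀ {x y} z → x < y → x + z < y + z
    *-pos       : ∀ {x y} → 0# < x → 0# < y → 0# < x * y
    sqrt        : ∀ x → 0# < x → ∃ λ y → y * y ≈ x
    oddRoot     : ∀ k (cs : Vec Carrier (suc (2 ℕ.* k))) → ∃ λ x → evalMonic cs x ≈ 0#

RealRooted : {c ℓ : Level} → RealClosedField c ℓ → (ℕ → ℕ) → Set (c ⊔ ℓ)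
RealRooted R a =
  Σ Carrier λ lc → Σ (List Carrier) λ rs →
    ¬ (lc ≈ 0#) × (∀ i → fromℕ (a i) ≈ lc * coeff (prodLin rs) i)
  where open RealClosedField R

module Submission where

-- An independent set of G ∘ K_p consists of an independent set A of G together with, in the
-- clique attached to each vertex v, no vertex if v ∈ A and at most one vertex otherwise. Hence
--   I(G ∘ K_p; x) = ∑_A x^|A| (1 + p x)^(n - |A|) = (1 + p x)^n I(G; x / (1 + p x)).
-- The roots of I(G; x) are negative (its coefficients are nonnegative and s₀ = 1), so
-- I(G; x) = c ∏ᵢ (x + aᵢ) with aᵢ > 0 and d ≤ n factors, and then
--   I(G ∘ K_p; x) = c ∏ᵢ (x + aᵢ (1 + p x)) · (1 + p x)^(n - d)
-- is again a product of linear factors with negative roots; induct along the iterated coronas.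
-- A product of factors x + a with a > 0 is log-concave with no internal zeros, hence unimodal.
-- Finally, a maximal independent set of G ∘ K_p meets each of the n sets {v} ∪ K_p in exactly
-- one vertex; when p ≥ 2 this survives deleting any one vertex, so G ∘ K_p is 1-well-covered.

open import Defs
open import Level using (Level)
open import Data.Nat as ℕ using (ℕ; zero; suc; _≤_; z≤n; s≤s)
open import Data.Product using (_×_; _,_; proj₁; proj₂; ∃)
open import Function using (_∘_)
open import Algebra.Bundles using (CommutativeSemiring)

module Sequences {c ℓ : Level} (S : CommutativeSemiring c ℓ) where

  import Relation.Binary.PropositionalEquality as ≡
  import Data.Nat.Properties as ℕₚ
  open import Relation.Binary.Bundles using (Setoid)
  import Relation.Binary.Reasoning.Setoid as SetoidReasoning
  open CommutativeSemiring S renaming (refl to ≈-refl; sym to ≈-sym; trans to ≈-trans)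
  open import Algebra.Solver.Ring.NaturalCoefficients.Default S using (solve; _:+_; _:*_; _:=_)

  Seq : Set c
  Seq = ℕ → Carrier

  infix 4 _≋_
  _≋_ : Seq → Seq → Set ℓ
  f ≋ g = ∀ k → f k ≈ g k

  ≋-setoid : Setoid c ℓ
  ≋-setoid = record
    { Carrier       = Seq
    ; _≈_           = _≋_
    ; isEquivalence = record
      { refl  = λ _ → ≈-refl
      ; sym   = λ f≋g k → ≈-sym (f≋g k)
      ; trans = λ f≋g g≋h k → ≈-trans (f≋g k) (g≋h k)
      }
    }

  module ≋-Reasoning = SetoidReasoning ≋-setoid
  open Setoid ≋-setoid public using () renaming (refl to ≋-refl; sym to ≋-sym; trans to ≋-trans)

  ≡⇒≋ : ∀ {f g} → f ≡.≡ g → f ≋ g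
  ≡⇒≋ ≡.refl = ≋-refl

  infixl 6 _⊕_
  _⊕_ : Seq → Seq → Seq
  (f ⊕ g) k = f k + g k

  scale : Carrier → Seq → Seq
  scale a f k = a * f k

  shift : Seq → Seq
  shift f zero    = 0#
  shift f (suc k) = f k

  one : Seq
  one zero    = 1#
  one (suc k) = 0#

  shiftBy : ℕ → Seq → Seq
  shiftBy zero    f = f
  shiftBy (suc c) f = shift (shiftBy c f)

  monomial : ℕ → Seq
  monomial d = shiftBy d one

  Degree≤ : ℕ → Seq → Set ℓ
  Degree≤ d f = ∀ i → d ℕ.< i → f i ≈ 0#

  Degree≤-mono : ∀ {d e} f → d ≤ e → Degree≤ d f → Degree≤ e f
  Degree≤-mono f d≤e deg i e<i = deg i (ℕₚ.≤-<-trans d≤e e<i)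

  monomial-degree : ∀ d → Degree≤ d (monomial d)
  monomial-degree zero    (suc i) _         = ≈-refl
  monomial-degree (suc d) (suc i) (s≤s d<i) = monomial-degree d i d<i

  ⊕-cong : ∀ {f f′ g g′} → f ≋ f′ → g ≋ g′ → f ⊕ g ≋ f′ ⊕ g′
  ⊕-cong f≋f′ g≋g′ k = +-cong (f≋f′ k) (g≋g′ k)

  scale-cong : ∀ a {f g} → f ≋ g → scale a f ≋ scale a g
  scale-cong a f≋g k = *-congˡ (f≋g k)

  scale-congˡ : ∀ {a b} f → a ≈ b → scale a f ≋ scale b f
  scale-congˡ f a≈b k = *-congʳ a≈b

  shift-cong : ∀ {f g} → f ≋ g → shift f ≋ shift g
  shift-cong f≋g zero    = ≈-refl
  shift-cong f≋g (suc k) = f≋g k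

  shift-⊕ : ∀ f g → shift (f ⊕ g) ≋ shift f ⊕ shift g
  shift-⊕ f g zero    = ≈-sym (+-identityˡ 0#)
  shift-⊕ f g (suc k) = ≈-refl

  shift-scale : ∀ a f → shift (scale a f) ≋ scale a (shift f)
  shift-scale a f zero    = ≈-sym (zeroʳ a)
  shift-scale a f (suc k) = ≈-refl

  shiftBy-cong : ∀ c {f g} → f ≋ g → shiftBy c f ≋ shiftBy c g
  shiftBy-cong zero    f≋g = f≋g
  shiftBy-cong (suc c) f≋g = shift-cong (shiftBy-cong c f≋g)

  shiftBy-shift : ∀ c f → shiftBy c (shift f) ≋ shiftBy (suc c) f
  shiftBy-shift zero    f = ≋-refl
  shiftBy-shift (suc c) f = shift-cong (shiftBy-shift c f)

  shiftBy-⊕ : ∀ c f g → shiftBy c (f ⊕ g) ≋ shiftBy c f ⊕ shiftBy c g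
  shiftBy-⊕ zero    f g = ≋-refl
  shiftBy-⊕ (suc c) f g = ≋-trans (shift-cong (shiftBy-⊕ c f g)) (shift-⊕ _ _)

  shiftBy-scale : ∀ c a f → shiftBy c (scale a f) ≋ scale a (shiftBy c f)
  shiftBy-scale zero    a f = ≋-refl
  shiftBy-scale (suc c) a f = ≋-trans (shift-cong (shiftBy-scale c a f)) (shift-scale a _)

  scale-scale : ∀ a b f → scale a (scale b f) ≋ scale (a * b) f
  scale-scale a b f k = ≈-sym (*-assoc a b (f k))

  module Homogenise (p : Carrier) where

    mul1+px : Seq → Seq
    mul1+px f = f ⊕ scale p (shift f)

    pow1+px : ℕ → Seq
    pow1+px zero    = one
    pow1+px (suc m) = mul1+px (pow1+px m)

    -- For deg f ≤ m, the coefficients of (1 + p x)^m f(x / (1 + p x)) = ∑ⱼ fⱼ xʲ (1 + p x)^(m - j).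
    homogenise : ℕ → Seq → Seq
    homogenise zero    f = scale (f 0) one
    homogenise (suc m) f = scale (f 0) (pow1+px (suc m)) ⊕ shift (homogenise m (f ∘ suc))

    mul1+px-cong : ∀ {f g} → f ≋ g → mul1+px f ≋ mul1+px g
    mul1+px-cong f≋g = ⊕-cong f≋g (scale-cong p (shift-cong f≋g))

    mul1+px-⊕ : ∀ f g → mul1+px (f ⊕ g) ≋ mul1+px f ⊕ mul1+px g
    mul1+px-⊕ f g k = ≈-trans (+-congˡ (*-congˡ (shift-⊕ f g k))) (shuffle (f k) (g k) p (shift f k) (shift g k))
      where
      shuffle : ∀ a b q c d → a + b + q * (c + d) ≈ a + q * c + (b + q * d)
      shuffle = solve 5 (λ a b q c d → a :+ b :+ q :* (c :+ d) := a :+ q :* c :+ (b :+ q :* d)) ≈-refl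

    mul1+px-scale : ∀ a f → mul1+px (scale a f) ≋ scale a (mul1+px f)
    mul1+px-scale a f k = ≈-trans (+-congˡ (*-congˡ (shift-scale a f k))) (factor a (f k) p (shift f k))
      where
      factor : ∀ a x q s → a * x + q * (a * s) ≈ a * (x + q * s)
      factor = solve 4 (λ a x q s → a :* x :+ q :* (a :* s) := a :* (x :+ q :* s)) ≈-refl

    mul1+px-shift : ∀ f → mul1+px (shift f) ≋ shift (mul1+px f)
    mul1+px-shift f zero    = ≈-trans (+-congˡ (zeroʳ p)) (+-identityˡ 0#)
    mul1+px-shift f (suc k) = ≈-refl

    homogenise-cong : ∀ m {f g} → f ≋ g → homogenise m f ≋ homogenise m g
    homogenise-cong zero    f≋g k = *-congʳ (f≋g 0)
    homogenise-cong (suc m) f≋g   = ⊕-cong (scale-congˡ _ (f≋g 0)) (shift-cong (homogenise-cong m (f≋g ∘ suc)))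

    homogenise-⊕ : ∀ m f g → homogenise m (f ⊕ g) ≋ homogenise m f ⊕ homogenise m g
    homogenise-⊕ zero    f g k = distribʳ (one k) (f 0) (g 0)
    homogenise-⊕ (suc m) f g k =
      ≈-trans (+-cong (distribʳ (pow1+px (suc m) k) (f 0) (g 0))
                    (≈-trans (shift-cong (homogenise-⊕ m (f ∘ suc) (g ∘ suc)) k) (shift-⊕ _ _ k)))
            (interchange _ _ _ _)
      where
      interchange : ∀ a b c d → a + b + (c + d) ≈ a + c + (b + d)
      interchange = solve 4 (λ a b c d → a :+ b :+ (c :+ d) := a :+ c :+ (b :+ d)) ≈-refl

    homogenise-scale : ∀ m a f → homogenise m (scale a f) ≋ scale a (homogenise m f)
    homogenise-scale zero    a f k = *-assoc a (f 0) (one k)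
    homogenise-scale (suc m) a f k =
      ≈-trans (+-cong (*-assoc a (f 0) (pow1+px (suc m) k))
                    (≈-trans (shift-cong (homogenise-scale m a (f ∘ suc)) k) (shift-scale a _ k)))
            (≈-sym (distribˡ a _ _))

    homogenise-shift : ∀ m f → homogenise (suc m) (shift f) ≋ shift (homogenise m f)
    homogenise-shift m f k = ≈-trans (+-congʳ (zeroˡ _)) (+-identityˡ _)

    homogenise-suc : ∀ m f → Degree≤ m f → homogenise (suc m) f ≋ mul1+px (homogenise m f)
    homogenise-suc zero f deg = begin
      scale (f 0) (mul1+px one) ⊕ shift (scale (f 1) one) ≈⟨ ⊕-cong ≋-refl (shift-cong f₁·1≋0) ⟩
      scale (f 0) (mul1+px one) ⊕ shift (λ _ → 0#)
        ≈⟨ (λ k → ≈-trans (+-congˡ (shift-zero k)) (+-identityʳ _)) ⟩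
      scale (f 0) (mul1+px one)                           ≈⟨ mul1+px-scale (f 0) one ⟨
      mul1+px (scale (f 0) one)                           ∎
      where
      open ≋-Reasoning
      f₁·1≋0 : scale (f 1) one ≋ (λ _ → 0#)
      f₁·1≋0 k = ≈-trans (*-congʳ (deg 1 (s≤s z≤n))) (zeroˡ (one k))
      shift-zero : shift (λ _ → 0#) ≋ (λ _ → 0#)
      shift-zero zero    = ≈-refl
      shift-zero (suc k) = ≈-refl
    homogenise-suc (suc m) f deg = begin
      scale (f 0) (mul1+px Pₘ) ⊕ shift (homogenise (suc m) (f ∘ suc))
        ≈⟨ ⊕-cong (≋-sym (mul1+px-scale (f 0) Pₘ))
                  (shift-cong (homogenise-suc m (f ∘ suc) (λ i → deg (suc i) ∘ s≤s))) ⟩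
      mul1+px (scale (f 0) Pₘ) ⊕ shift (mul1+px (homogenise m (f ∘ suc)))
        ≈⟨ ⊕-cong ≋-refl (mul1+px-shift _) ⟨
      mul1+px (scale (f 0) Pₘ) ⊕ mul1+px (shift (homogenise m (f ∘ suc)))
        ≈⟨ mul1+px-⊕ _ _ ⟨
      mul1+px (homogenise (suc m) f) ∎
      where
      open ≋-Reasoning
      Pₘ = pow1+px (suc m)

    homogenise-one : ∀ m → homogenise m one ≋ pow1+px m
    homogenise-one zero    k = *-identityˡ (one k)
    homogenise-one (suc m) =
      ≋-trans (homogenise-suc m one λ { (suc i) _ → ≈-refl }) (mul1+px-cong (homogenise-one m))

module IndependentSets where

  open import Function using (_⇔_; mk⇔; Equivalence)
  open import Function.Properties.Equivalence using () renaming (trans to ⇔-trans; sym to ⇔-sym)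
  open import Data.Product.Function.NonDependent.Propositional using (_×-⇔_)
  open import Data.Bool using (Bool; true; false; _∧_; not; T)
  open import Data.Bool.ListAction using (and)
  open import Data.Bool.Properties using (T-≡; ¬-not; not-¬; ∧-zeroʳ; ⇔→≡)
  open import Data.Nat using (_+_; _*_; _≡ᵇ_; _<ᵇ_)
  import Data.Nat.Properties as ℕₚ
  open import Data.Nat.Tactic.RingSolver using (solve-∀)
  import Algebra.Properties.CommutativeSemigroup as CommSemigroupProperties
  open import Data.Fin as Fin using (Fin; zero; suc; _↑ˡ_; _↑ʳ_; combine; remQuot)
  import Data.Fin.Properties as Finₚ
  open import Data.Vec as Vec using (Vec; []; _∷_; lookup; _++_; concat; _[_]≔_)
  import Data.Vec.Properties as Vecₚ
  open import Data.List as List using (List; []; _∷_; length; filterᵇ; allFin)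
  import Data.List.Properties as Listₚ
  import Data.List.Membership.Propositional.Properties as ∈ₚ
  import Data.List.Relation.Unary.All as All
  import Data.List.Relation.Unary.All.Properties as Allₚ
  open import Data.Sum using (inj₁; inj₂)
  open import Data.Empty using (⊥)
  open import Relation.Nullary using (¬_; does; yes; no; contradiction)
  open import Relation.Nullary.Decidable using (T?; dec-true; dec-false; decidable-stable)
  open import Relation.Binary.PropositionalEquality

  module +-CS = CommSemigroupProperties ℕₚ.+-commutativeSemigroup
  open Sequences ℕₚ.+-*-commutativeSemiring

  -- Sums over vertex subsets

  iverson : Bool → ℕ
  iverson true  = 1
  iverson false = 0

  iverson-∧ : ∀ x y → iverson (x ∧ y) ≡ iverson x * iverson y
  iverson-∧ true  y = sym (ℕₚ.+-identityʳ (iverson y))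
  iverson-∧ false y = refl

  subsetSum : (n : ℕ) → (VSet n → ℕ) → ℕ
  subsetSum zero    f = f []
  subsetSum (suc n) f = subsetSum n (f ∘ (true ∷_)) + subsetSum n (f ∘ (false ∷_))

  subsetSum-cong : ∀ n {f g : VSet n → ℕ} → (∀ S → f S ≡ g S) → subsetSum n f ≡ subsetSum n g
  subsetSum-cong zero    f≗g = f≗g []
  subsetSum-cong (suc n) f≗g =
    cong₂ _+_ (subsetSum-cong n (f≗g ∘ (true ∷_))) (subsetSum-cong n (f≗g ∘ (false ∷_)))

  subsetSum-zero : ∀ n → subsetSum n (λ _ → 0) ≡ 0
  subsetSum-zero zero    = refl
  subsetSum-zero (suc n) = cong₂ _+_ (subsetSum-zero n) (subsetSum-zero n)

  subsetSum-++ : ∀ m {n} (f : VSet (m + n) → ℕ) →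
                 subsetSum (m + n) f ≡ subsetSum m (λ A → subsetSum n (λ B → f (A ++ B)))
  subsetSum-++ zero    f = refl
  subsetSum-++ (suc m) f = cong₂ _+_ (subsetSum-++ m (f ∘ (true ∷_))) (subsetSum-++ m (f ∘ (false ∷_)))

  subsetSum-*ˡ : ∀ n a (f : VSet n → ℕ) → subsetSum n (λ S → a * f S) ≡ a * subsetSum n f
  subsetSum-*ˡ zero    a f = refl
  subsetSum-*ˡ (suc n) a f =
    trans (cong₂ _+_ (subsetSum-*ˡ n a _) (subsetSum-*ˡ n a _)) (sym (ℕₚ.*-distribˡ-+ a _ _))

  subsetSum-card<1 : ∀ n (h : ℕ → ℕ) → subsetSum n (λ S → iverson (card S <ᵇ 1) * h (card S)) ≡ h 0
  subsetSum-card<1 zero    h = ℕₚ.+-identityʳ (h 0)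
  subsetSum-card<1 (suc n) h = cong₂ _+_ (subsetSum-zero n) (subsetSum-card<1 n h)

  subsetSum-card≡0 : ∀ n (f : VSet n → ℕ) →
                     subsetSum n (λ S → f S * iverson (card S ≡ᵇ 0)) ≡ f (Vec.replicate n false)
  subsetSum-card≡0 zero    f = ℕₚ.*-identityʳ (f [])
  subsetSum-card≡0 (suc n) f =
    cong₂ _+_ (trans (subsetSum-cong n (λ S → ℕₚ.*-zeroʳ (f (true ∷ S)))) (subsetSum-zero n))
              (subsetSum-card≡0 n (f ∘ (false ∷_)))

  subsetSum-card<2 : ∀ n (h : ℕ → ℕ) →
                     subsetSum n (λ S → iverson (card S <ᵇ 2) * h (card S)) ≡ h 0 + n * h 1
  subsetSum-card<2 zero    h = trans (ℕₚ.+-identityʳ (h 0)) (sym (ℕₚ.+-identityʳ (h 0)))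
  subsetSum-card<2 (suc n) h = begin
    subsetSum n (λ S → iverson (card S <ᵇ 1) * h (suc (card S))) +
    subsetSum n (λ S → iverson (card S <ᵇ 2) * h (card S))
      ≡⟨ cong₂ _+_ (subsetSum-card<1 n (h ∘ suc)) (subsetSum-card<2 n h) ⟩
    h 1 + (h 0 + n * h 1)
      ≡⟨ +-CS.x∙yz≈y∙xz (h 1) (h 0) (n * h 1) ⟩
    h 0 + (h 1 + n * h 1) ∎
    where open ≡-Reasoning

  length-filterᵇ-map : ∀ {A B : Set} (P : B → Bool) (f : A → B) xs →
                       length (filterᵇ P (List.map f xs)) ≡ length (filterᵇ (P ∘ f) xs)
  length-filterᵇ-map P f []       = refl
  length-filterᵇ-map P f (x ∷ xs) with P (f x)
  ... | true  = cong suc (length-filterᵇ-map P f xs)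
  ... | false = length-filterᵇ-map P f xs

  length-filterᵇ-allSubsets : ∀ n (P : VSet n → Bool) →
                              length (filterᵇ P (allSubsets n)) ≡ subsetSum n (iverson ∘ P)
  length-filterᵇ-allSubsets zero    P with P []
  ... | true  = refl
  ... | false = refl
  length-filterᵇ-allSubsets (suc n) P = begin
    length (filterᵇ P (List.map (true ∷_) Sₙ List.++ List.map (false ∷_) Sₙ))
      ≡⟨ cong length (Listₚ.filter-++ (T? ∘ P) (List.map (true ∷_) Sₙ) _) ⟩
    length (filterᵇ P (List.map (true ∷_) Sₙ) List.++ filterᵇ P (List.map (false ∷_) Sₙ))
      ≡⟨ Listₚ.length-++ (filterᵇ P (List.map (true ∷_) Sₙ)) ⟩
    length (filterᵇ P (List.map (true ∷_) Sₙ)) + length (filterᵇ P (List.map (false ∷_) Sₙ))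
      ≡⟨ cong₂ _+_ (length-filterᵇ-map P (true ∷_) Sₙ) (length-filterᵇ-map P (false ∷_) Sₙ) ⟩
    length (filterᵇ (P ∘ (true ∷_)) Sₙ) + length (filterᵇ (P ∘ (false ∷_)) Sₙ)
      ≡⟨ cong₂ _+_ (length-filterᵇ-allSubsets n _) (length-filterᵇ-allSubsets n _) ⟩
    subsetSum (suc n) (iverson ∘ P) ∎
    where
    open ≡-Reasoning
    Sₙ = allSubsets n

  card-∷ : ∀ {n} x (A : VSet n) → card (x ∷ A) ≡ iverson x + card A
  card-∷ true  A = refl
  card-∷ false A = refl

  card-++ : ∀ {m n} (A : VSet m) (B : VSet n) → card (A ++ B) ≡ card A + card B
  card-++ []          B = refl
  card-++ (true ∷ A)  B = cong suc (card-++ A B)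
  card-++ (false ∷ A) B = card-++ A B

  card≤ : ∀ {n} (S : VSet n) → card S ℕ.≤ n
  card≤ []          = z≤n
  card≤ (true ∷ S)  = s≤s (card≤ S)
  card≤ (false ∷ S) = ℕₚ.m≤n⇒m≤1+n (card≤ S)

  indepCoeff≡subsetSum : ∀ {n} (G : Graph n) k →
    indepCoeff G k ≡ subsetSum n (λ S → iverson (independentᵇ G S) * iverson (card S ≡ᵇ k))
  indepCoeff≡subsetSum {n} G k =
    trans (length-filterᵇ-allSubsets n _) (subsetSum-cong n (λ S → iverson-∧ (independentᵇ G S) _))

  T-not-∧∧ : ∀ {a b c} → T (not (a ∧ b ∧ c)) ⇔ (a ≡ true → b ≡ true → c ≡ false)
  T-not-∧∧ {true}  {true}  {true}  = mk⇔ (λ ()) (λ h → contradiction (h refl refl) λ ())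
  T-not-∧∧ {true}  {true}  {false} = mk⇔ (λ _ _ _ → refl) _
  T-not-∧∧ {true}  {false} {c}     = mk⇔ (λ _ _ ()) _
  T-not-∧∧ {false} {b}     {c}     = mk⇔ (λ _ ()) _

  independentᵇ⇔Independent : ∀ {n} (G : Graph n) S → independentᵇ G S ≡ true ⇔ Independent G S
  independentᵇ⇔Independent {n} G S = mk⇔
    (λ t u v → Equivalence.to T-not-∧∧
       (All.lookup (Allₚ.all⁺ (row u) _ (All.lookup (Allₚ.all⁺ rows _ (Equivalence.from T-≡ t)) (∈ₚ.∈-allFin u)))
                   (∈ₚ.∈-allFin v)))
    (λ I → Equivalence.to T-≡ (Allₚ.all⁻ rows (All.tabulate {xs = allFin n} λ {u} _ →
       Allₚ.all⁻ (row u) (All.tabulate {xs = allFin n} λ {v} _ → Equivalence.from T-not-∧∧ (I u v)))))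
    where
    row : Fin n → Fin n → Bool
    row u v = not (lookup S u ∧ lookup S v ∧ G u v)
    rows : Fin n → Bool
    rows u = and (List.map (row u) (allFin n))

  indepCoeff-zero : ∀ {n} (G : Graph n) → indepCoeff G 0 ≡ 1
  indepCoeff-zero {n} G = begin
    indepCoeff G 0                                      ≡⟨ indepCoeff≡subsetSum G 0 ⟩
    subsetSum n (λ S → iverson (independentᵇ G S) * iverson (card S ≡ᵇ 0))
                                                        ≡⟨ subsetSum-card≡0 n (iverson ∘ independentᵇ G) ⟩
    iverson (independentᵇ G ∅)                          ≡⟨ cong iverson (Equivalence.from (independentᵇ⇔Independent G ∅) ∅-independent) ⟩
    1                                                   ∎
    where
    open ≡-Reasoning
    ∅ = Vec.replicate n false
    ∅-independent : Independent G ∅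
    ∅-independent u v u∈ _ = contradiction (trans (sym (Vecₚ.lookup-replicate u false)) u∈) λ ()

  indepCoeff-beyond : ∀ {n} (G : Graph n) k → n ℕ.< k → indepCoeff G k ≡ 0
  indepCoeff-beyond {n} G k n<k =
    trans (indepCoeff≡subsetSum G k) (trans (subsetSum-cong n term≡0) (subsetSum-zero n))
    where
    term≡0 : ∀ S → iverson (independentᵇ G S) * iverson (card S ≡ᵇ k) ≡ 0
    term≡0 S with card S ≡ᵇ k in eq
    ... | false = ℕₚ.*-zeroʳ (iverson (independentᵇ G S))
    ... | true  = contradiction (subst (ℕ._≤ n) (ℕₚ.≡ᵇ⇒≡ (card S) k (Equivalence.from T-≡ eq)) (card≤ S))
                                (ℕₚ.<⇒≱ n<k)

  -- Pendant cliques

  Empty : ∀ {p} → VSet p → Set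
  Empty B = ∀ a → ¬ a ∈ᵥ B

  AtMostOne : ∀ {p} → VSet p → Set
  AtMostOne B = ∀ a b → a ∈ᵥ B → b ∈ᵥ B → a ≡ b

  -- B can be the trace of an independent set of G ∘ K_p on the clique attached to a base vertex
  -- whose membership in the set is x.
  Compatible : ∀ {p} → Bool → VSet p → Set
  Compatible x B = ∀ a → a ∈ᵥ B → x ≡ false × (∀ b → b ∈ᵥ B → a ≡ b)

  card<1⇒Empty : ∀ {p} (B : VSet p) → (card B <ᵇ 1) ≡ true → Empty B
  card<1⇒Empty (false ∷ B) h zero    ()
  card<1⇒Empty (false ∷ B) h (suc a) = card<1⇒Empty B h a

  Empty⇒card<1 : ∀ {p} (B : VSet p) → Empty B → (card B <ᵇ 1) ≡ true
  Empty⇒card<1 []          _ = refl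
  Empty⇒card<1 (true ∷ B)  e = contradiction refl (e zero)
  Empty⇒card<1 (false ∷ B) e = Empty⇒card<1 B (e ∘ suc)

  card<2⇒AtMostOne : ∀ {p} (B : VSet p) → (card B <ᵇ 2) ≡ true → AtMostOne B
  card<2⇒AtMostOne (true ∷ B)  h zero    zero    _  _  = refl
  card<2⇒AtMostOne (true ∷ B)  h zero    (suc b) _  b∈ = contradiction b∈ (card<1⇒Empty B h b)
  card<2⇒AtMostOne (true ∷ B)  h (suc a) _       a∈ _  = contradiction a∈ (card<1⇒Empty B h a)
  card<2⇒AtMostOne (false ∷ B) h (suc a) (suc b) a∈ b∈ = cong suc (card<2⇒AtMostOne B h a b a∈ b∈)

  AtMostOne⇒card<2 : ∀ {p} (B : VSet p) → AtMostOne B → (card B <ᵇ 2) ≡ true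
  AtMostOne⇒card<2 []          _   = refl
  AtMostOne⇒card<2 (true ∷ B)  amo = Empty⇒card<1 B (λ a a∈ → Finₚ.0≢1+n (amo zero (suc a) refl a∈))
  AtMostOne⇒card<2 (false ∷ B) amo =
    AtMostOne⇒card<2 B (λ a b a∈ b∈ → Finₚ.suc-injective (amo (suc a) (suc b) a∈ b∈))

  <ᵇ1⇒≡0 : ∀ m → (m <ᵇ 1) ≡ true → m ≡ 0
  <ᵇ1⇒≡0 zero _ = refl

  compatibleᵇ : ∀ {p} → Bool → VSet p → Bool
  compatibleᵇ true  B = card B <ᵇ 1
  compatibleᵇ false B = card B <ᵇ 2

  compatibleᵇ⇔Compatible : ∀ {p} x (B : VSet p) → compatibleᵇ x B ≡ true ⇔ Compatible x B
  compatibleᵇ⇔Compatible true  B = mk⇔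
    (λ h a a∈ → contradiction a∈ (card<1⇒Empty B h a))
    (λ c → Empty⇒card<1 B (λ a a∈ → contradiction (proj₁ (c a a∈)) λ ()))
  compatibleᵇ⇔Compatible false B = mk⇔
    (λ h a a∈ → refl , λ b b∈ → card<2⇒AtMostOne B h a b a∈ b∈)
    (λ c → AtMostOne⇒card<2 B (λ a b a∈ b∈ → proj₂ (c a a∈) b b∈))

  compatiblesᵇ : ∀ {n p} → VSet n → Vec (VSet p) n → Bool
  compatiblesᵇ []      []       = true
  compatiblesᵇ (x ∷ A) (B ∷ Bs) = compatibleᵇ x B ∧ compatiblesᵇ A Bs

  ∧≡true⇔ : ∀ {x y} → x ∧ y ≡ true ⇔ (x ≡ true × y ≡ true)
  ∧≡true⇔ {true}  = mk⇔ (refl ,_) proj₂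
  ∧≡true⇔ {false} = mk⇔ (λ ()) proj₁

  compatiblesᵇ⇔Compatible : ∀ {n p} (A : VSet n) (Bs : Vec (VSet p) n) →
                            compatiblesᵇ A Bs ≡ true ⇔ (∀ v → Compatible (lookup A v) (lookup Bs v))
  compatiblesᵇ⇔Compatible []      []       = mk⇔ (λ _ ()) (λ _ → refl)
  compatiblesᵇ⇔Compatible (x ∷ A) (B ∷ Bs) = mk⇔
    (λ h → let hB , hBs = Equivalence.to ∧≡true⇔ h in
       λ { zero → Equivalence.to (compatibleᵇ⇔Compatible x B) hB
         ; (suc v) → Equivalence.to (compatiblesᵇ⇔Compatible A Bs) hBs v })
    (λ c → Equivalence.from ∧≡true⇔
       ( Equivalence.from (compatibleᵇ⇔Compatible x B) (c zero)
       , Equivalence.from (compatiblesᵇ⇔Compatible A Bs) (c ∘ suc)))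

  -- Well-coveredness

  MaximalOutside : ∀ {n} → Graph n → (Fin n → Set) → VSet n → Set
  MaximalOutside G E S = Independent G S × (∀ y → ¬ E y → ¬ y ∈ᵥ S → ¬ Independent G (S [ y ]≔ true))

  Maximal⇒MaximalOutside : ∀ {n} {G : Graph n} {S} E → MaximalIndependent G S → MaximalOutside G E S
  Maximal⇒MaximalOutside E (I , maximal) = I , λ y _ → maximal y

  Independent-[]≔ : ∀ {n} (G : Graph n) S x → Independent G S → G x x ≡ false →
                    (∀ y → y ∈ᵥ S → G x y ≡ false × G y x ≡ false) → Independent G (S [ x ]≔ true)
  Independent-[]≔ G S x I loopless separated u v u∈ v∈ with u Fin.≟ x | v Fin.≟ x
  ... | yes refl | yes refl = loopless
  ... | yes refl | no v≢x   = proj₁ (separated v (trans (sym (Vecₚ.lookup∘update′ v≢x S true)) v∈))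
  ... | no u≢x   | yes refl = proj₂ (separated u (trans (sym (Vecₚ.lookup∘update′ u≢x S true)) u∈))
  ... | no u≢x   | no v≢x   =
    I u v (trans (sym (Vecₚ.lookup∘update′ u≢x S true)) u∈) (trans (sym (Vecₚ.lookup∘update′ v≢x S true)) v∈)

  card-insertAt : ∀ {n} (S : VSet n) x → card (Vec.insertAt S x false) ≡ card S
  card-insertAt S           zero    = refl
  card-insertAt (true ∷ S)  (suc x) = cong suc (card-insertAt S x)
  card-insertAt (false ∷ S) (suc x) = card-insertAt S x

  insertAt-[]≔ : ∀ {n} (S : VSet n) x y →
                 Vec.insertAt S x false [ Fin.punchIn x y ]≔ true ≡ Vec.insertAt (S [ y ]≔ true) x false
  insertAt-[]≔ (s ∷ S) zero    y       = refl
  insertAt-[]≔ (s ∷ S) (suc x) zero    = refl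
  insertAt-[]≔ (s ∷ S) (suc x) (suc y) = cong (s ∷_) (insertAt-[]≔ S x y)

  Independent-deleteVertex : ∀ {n} (G : Graph (suc n)) x S →
                             Independent G (Vec.insertAt S x false) → Independent (deleteVertex G x) S
  Independent-deleteVertex G x S I u v u∈ v∈ =
    I _ _ (trans (Vecₚ.insertAt-punchIn S x false u) u∈) (trans (Vecₚ.insertAt-punchIn S x false v) v∈)

  maximalOutside-insertAt : ∀ {n} (G : Graph (suc n)) x S →
    MaximalIndependent (deleteVertex G x) S → MaximalOutside G (_≡ x) (Vec.insertAt S x false)
  maximalOutside-insertAt G x S (I , maximal) = independent , maximalOutside
    where
    S⁺ = Vec.insertAt S x false
    punchedIn : ∀ u → u ∈ᵥ S⁺ → ∃ λ u′ → u ≡ Fin.punchIn x u′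
    punchedIn u u∈ with x Fin.≟ u
    ... | yes refl = contradiction (trans (sym u∈) (Vecₚ.insertAt-lookup S x false)) λ ()
    ... | no x≢u   = Fin.punchOut x≢u , sym (Finₚ.punchIn-punchOut x≢u)
    independent : Independent G S⁺
    independent u v u∈ v∈ with punchedIn u u∈ | punchedIn v v∈
    ... | u′ , refl | v′ , refl =
      I u′ v′ (trans (sym (Vecₚ.insertAt-punchIn S x false u′)) u∈)
              (trans (sym (Vecₚ.insertAt-punchIn S x false v′)) v∈)
    maximalOutside : ∀ y → ¬ y ≡ x → ¬ y ∈ᵥ S⁺ → ¬ Independent G (S⁺ [ y ]≔ true)
    maximalOutside y y≢x y∉ I⁺ with x Fin.≟ y
    ... | yes x≡y = y≢x (sym x≡y)
    ... | no  x≢y with Fin.punchOut x≢y | Finₚ.punchIn-punchOut x≢y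
    ...   | y′ | refl = maximal y′ (y∉ ∘ trans (Vecₚ.insertAt-punchIn S x false y′))
      (Independent-deleteVertex G x (S [ y′ ]≔ true) (subst (Independent G) (insertAt-[]≔ S x y′) I⁺))

  oneWellCovered : ∀ {n} (G : Graph n) m → 2 ≤ n →
    (∀ S → MaximalIndependent G S → card S ≡ m) → (∀ x S → MaximalOutside G (_≡ x) S → card S ≡ m) →
    OneWellCovered G
  oneWellCovered G m (s≤s (s≤s _)) maximal-card maximalOutside-card =
      (λ S T S-max T-max → trans (maximal-card S S-max) (sym (maximal-card T T-max)))
    , λ x S T S-max T-max → trans (card-deleteVertex x S S-max) (sym (card-deleteVertex x T T-max))
    where
    card-deleteVertex : ∀ x S → MaximalIndependent (deleteVertex G x) S → card S ≡ m
    card-deleteVertex x S S-max =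
      trans (sym (card-insertAt S x)) (maximalOutside-card x (Vec.insertAt S x false) (maximalOutside-insertAt G x S S-max))

  blockSum : ∀ n {p} → (Vec (VSet p) n → ℕ) → ℕ
  blockSum zero        f = f []
  blockSum (suc n) {p} f = subsetSum p (λ B → blockSum n (f ∘ (B ∷_)))

  blockSum-cong : ∀ n {p} {f g : Vec (VSet p) n → ℕ} → (∀ Bs → f Bs ≡ g Bs) → blockSum n f ≡ blockSum n g
  blockSum-cong zero        f≗g = f≗g []
  blockSum-cong (suc n) {p} f≗g = subsetSum-cong p (λ B → blockSum-cong n (f≗g ∘ (B ∷_)))

  blockSum-*ˡ : ∀ n {p} a (f : Vec (VSet p) n → ℕ) → blockSum n (λ Bs → a * f Bs) ≡ a * blockSum n f
  blockSum-*ˡ zero        a f = refl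
  blockSum-*ˡ (suc n) {p} a f = trans (subsetSum-cong p (λ B → blockSum-*ˡ n a _)) (subsetSum-*ˡ p a _)

  subsetSum-concat : ∀ n p (f : VSet (n * p) → ℕ) → subsetSum (n * p) f ≡ blockSum n (f ∘ concat)
  subsetSum-concat zero    p f = refl
  subsetSum-concat (suc n) p f =
    trans (subsetSum-++ p f) (subsetSum-cong p (λ B → subsetSum-concat n p (f ∘ (B ++_))))

  card-blocks : ∀ {n p} (A : VSet n) (Bs : Vec (VSet p) n) →
                (∀ v → iverson (lookup A v) + card (lookup Bs v) ≡ 1) → card A + card (concat Bs) ≡ n
  card-blocks []      []       _     = refl
  card-blocks (x ∷ A) (B ∷ Bs) single = begin
    card (x ∷ A) + card (B ++ concat Bs)             ≡⟨ cong₂ _+_ (card-∷ x A) (card-++ B (concat Bs)) ⟩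
    iverson x + card A + (card B + card (concat Bs)) ≡⟨ +-CS.interchange (iverson x) (card A) (card B) _ ⟩
    iverson x + card B + (card A + card (concat Bs)) ≡⟨ cong₂ _+_ (single zero) (card-blocks A Bs (single ∘ suc)) ⟩
    suc _                                            ∎
    where open ≡-Reasoning

  iverson-≡ᵇ : ∀ c k → iverson (c ≡ᵇ k) ≡ monomial c k
  iverson-≡ᵇ zero    zero    = refl
  iverson-≡ᵇ zero    (suc k) = refl
  iverson-≡ᵇ (suc c) zero    = refl
  iverson-≡ᵇ (suc c) (suc k) = iverson-≡ᵇ c k

  module _ (p : ℕ) where
    open Homogenise p

    homogenise-subsetSum : ∀ m n (F : VSet n → Seq) →
      homogenise m (λ j → subsetSum n (λ A → F A j)) ≋ (λ k → subsetSum n (λ A → homogenise m (F A) k))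
    homogenise-subsetSum m zero    F = ≋-refl
    homogenise-subsetSum m (suc n) F =
      ≋-trans (homogenise-⊕ m _ _) (⊕-cong (homogenise-subsetSum m n _) (homogenise-subsetSum m n _))

    -- The number of ways to add pendant vertices to A, keeping it independent, so that the result
    -- has k - c elements; the offset c makes the induction on A go through.
    pendantCount : ∀ {n} → VSet n → ℕ → Seq
    pendantCount {n} A c k =
      blockSum n {p} (λ Bs → iverson (compatiblesᵇ A Bs) * iverson (c + (card A + card (concat Bs)) ≡ᵇ k))

    pendantCount≡ : ∀ {n} (A : VSet n) c → pendantCount A c ≋ shiftBy c (homogenise n (monomial (card A)))
    pendantCount≡ []      c k = trans (ℕₚ.+-identityʳ _)
      (trans (cong (λ m → iverson (m ≡ᵇ k)) (ℕₚ.+-identityʳ c))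
             (trans (iverson-≡ᵇ c k) (sym (shiftBy-cong c (homogenise-one 0) k))))
    pendantCount≡ {suc n} (x ∷ A) c k = begin
      subsetSum p (λ B → blockSum n (λ Bs →
        iverson (compatibleᵇ x B ∧ compatiblesᵇ A Bs) * iverson (c + (card (x ∷ A) + card (B ++ concat Bs)) ≡ᵇ k)))
        ≡⟨ subsetSum-cong p (λ B →
             trans (blockSum-cong n (regroup B)) (blockSum-*ˡ n (iverson (compatibleᵇ x B)) (rest B))) ⟩
      subsetSum p (λ B → iverson (compatibleᵇ x B) * pendantCount A (iverson x + card B + c) k)
        ≡⟨ subsetSum-cong p (λ B →
             cong (iverson (compatibleᵇ x B) *_) (pendantCount≡ A (iverson x + card B + c) k)) ⟩
      subsetSum p (λ B → iverson (compatibleᵇ x B) * shiftBy (iverson x + card B + c) (homogenise n (monomial (card A))) k)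
        ≡⟨ attach x ⟩
      shiftBy c (homogenise (suc n) (monomial (card (x ∷ A)))) k ∎
      where
      open ≡-Reasoning
      reassoc : ∀ c x a b d → c + ((x + a) + (b + d)) ≡ (x + b + c) + (a + d)
      reassoc = solve-∀
      rest : VSet p → Vec (VSet p) n → ℕ
      rest B Bs = iverson (compatiblesᵇ A Bs) * iverson ((iverson x + card B + c) + (card A + card (concat Bs)) ≡ᵇ k)
      regroup : ∀ B Bs →
        iverson (compatibleᵇ x B ∧ compatiblesᵇ A Bs) * iverson (c + (card (x ∷ A) + card (B ++ concat Bs)) ≡ᵇ k) ≡
        iverson (compatibleᵇ x B) * rest B Bs
      regroup B Bs
        rewrite iverson-∧ (compatibleᵇ x B) (compatiblesᵇ A Bs) | card-∷ x A | card-++ B (concat Bs)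
              | reassoc c (iverson x) (card A) (card B) (card (concat Bs)) = ℕₚ.*-assoc (iverson (compatibleᵇ x B)) _ _
      Hₐ = homogenise n (monomial (card A))
      attach : ∀ x → subsetSum p (λ B → iverson (compatibleᵇ x B) * shiftBy (iverson x + card B + c) Hₐ k) ≡
                     shiftBy c (homogenise (suc n) (monomial (card (x ∷ A)))) k
      attach true = begin
        subsetSum p (λ B → iverson (card B <ᵇ 1) * shiftBy (suc (card B + c)) Hₐ k)
          ≡⟨ subsetSum-card<1 p (λ j → shiftBy (suc (j + c)) Hₐ k) ⟩
        shiftBy (suc c) Hₐ k
          ≡⟨ shiftBy-shift c Hₐ k ⟨
        shiftBy c (shift Hₐ) k
          ≡⟨ shiftBy-cong c (homogenise-shift n (monomial (card A))) k ⟨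
        shiftBy c (homogenise (suc n) (monomial (suc (card A)))) k ∎
      attach false = begin
        subsetSum p (λ B → iverson (card B <ᵇ 2) * shiftBy (card B + c) Hₐ k)
          ≡⟨ subsetSum-card<2 p (λ j → shiftBy (j + c) Hₐ k) ⟩
        shiftBy c Hₐ k + p * shiftBy (suc c) Hₐ k
          ≡⟨ cong (λ m → shiftBy c Hₐ k + p * m) (shiftBy-shift c Hₐ k) ⟨
        shiftBy c Hₐ k + p * shiftBy c (shift Hₐ) k
          ≡⟨ ≋-trans (shiftBy-⊕ c _ _) (⊕-cong ≋-refl (shiftBy-scale c p _)) k ⟨
        shiftBy c (mul1+px Hₐ) k
          ≡⟨ shiftBy-cong c (homogenise-suc n _ (Degree≤-mono _ (card≤ A) (monomial-degree (card A)))) k ⟨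
        shiftBy c (homogenise (suc n) (monomial (card A))) k ∎

  independent-adjacent : ∀ {n} {G : Graph n} S {x y} → Independent G S → G x y ≡ true → x ∈ᵥ S → y ∈ᵥ S → ⊥
  independent-adjacent S I adj x∈ y∈ = contradiction (trans (sym adj) (I _ _ x∈ y∈)) λ ()

  -- Independent sets of a corona

  module Corona {n : ℕ} (p : ℕ) (G : Graph n) where

    baseVertex : Fin n → Fin (n + n * p)
    baseVertex u = u ↑ˡ n * p

    pendantVertex : Fin n → Fin p → Fin (n + n * p)
    pendantVertex v a = n ↑ʳ combine v a

    data VertexView : Fin (n + n * p) → Set where
      base    : ∀ u → VertexView (baseVertex u)
      pendant : ∀ v a → VertexView (pendantVertex v a)

    vertexView : ∀ x → VertexView x
    vertexView x with Fin.splitAt n x in eq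
    ... | inj₁ u = subst VertexView (Finₚ.splitAt⁻¹-↑ˡ eq) (base u)
    ... | inj₂ i = subst VertexView (trans (cong (n ↑ʳ_) (Finₚ.combine-remQuot {n} p i)) (Finₚ.splitAt⁻¹-↑ʳ eq))
                     (pendant (proj₁ (remQuot {n} p i)) (proj₂ (remQuot {n} p i)))

    corona-base-base : ∀ u v → corona p G (baseVertex u) (baseVertex v) ≡ G u v
    corona-base-base u v rewrite Finₚ.splitAt-↑ˡ n u (n * p) | Finₚ.splitAt-↑ˡ n v (n * p) = refl

    corona-base-pendant : ∀ u v a → corona p G (baseVertex u) (pendantVertex v a) ≡ does (u Fin.≟ v)
    corona-base-pendant u v a
      rewrite Finₚ.splitAt-↑ˡ n u (n * p) | Finₚ.splitAt-↑ʳ n (n * p) (combine {n} {p} v a) =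
      cong (λ (w , _) → does (u Fin.≟ w)) (Finₚ.remQuot-combine v a)

    corona-pendant-base : ∀ u a v → corona p G (pendantVertex u a) (baseVertex v) ≡ does (u Fin.≟ v)
    corona-pendant-base u a v
      rewrite Finₚ.splitAt-↑ˡ n v (n * p) | Finₚ.splitAt-↑ʳ n (n * p) (combine {n} {p} u a) =
      cong (λ (w , _) → does (w Fin.≟ v)) (Finₚ.remQuot-combine u a)

    corona-pendant-pendant : ∀ u a v b →
      corona p G (pendantVertex u a) (pendantVertex v b) ≡ does (u Fin.≟ v) ∧ not (does (a Fin.≟ b))
    corona-pendant-pendant u a v b
      rewrite Finₚ.splitAt-↑ʳ n (n * p) (combine {n} {p} u a) | Finₚ.splitAt-↑ʳ n (n * p) (combine {n} {p} v b) =
      cong₂ (λ (u′ , a′) (v′ , b′) → does (u′ Fin.≟ v′) ∧ not (does (a′ Fin.≟ b′)))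
            (Finₚ.remQuot-combine u a) (Finₚ.remQuot-combine v b)

    base-adjacent-pendant : ∀ v a → corona p G (baseVertex v) (pendantVertex v a) ≡ true
    base-adjacent-pendant v a = trans (corona-base-pendant v v a) (dec-true (v Fin.≟ v) refl)

    clique-adjacent : ∀ v {a b} → a ≢ b → corona p G (pendantVertex v a) (pendantVertex v b) ≡ true
    clique-adjacent v {a} {b} a≢b = trans (corona-pendant-pendant v a v b)
      (cong₂ (λ x y → x ∧ not y) (dec-true (v Fin.≟ v) refl) (dec-false (a Fin.≟ b) a≢b))

    pendants-nonadjacent : ∀ u a v b → (u ≡ v → a ≡ b) → corona p G (pendantVertex u a) (pendantVertex v b) ≡ false
    pendants-nonadjacent u a v b same with u Fin.≟ v in eq
    ... | no  _    = trans (corona-pendant-pendant u a v b) (cong (_∧ _) (cong does eq))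
    ... | yes u≡v  = trans (corona-pendant-pendant u a v b)
      (trans (cong (λ d → does (u Fin.≟ v) ∧ not d) (dec-true (a Fin.≟ b) (same u≡v))) (∧-zeroʳ _))

    module _ (A : VSet n) (Bs : Vec (VSet p) n) where

      base∈ : ∀ {u} → u ∈ᵥ A → baseVertex u ∈ᵥ (A ++ concat Bs)
      base∈ {u} = trans (Vecₚ.lookup-++ˡ A (concat Bs) u)

      base∈⁻ : ∀ {u} → baseVertex u ∈ᵥ (A ++ concat Bs) → u ∈ᵥ A
      base∈⁻ {u} = trans (sym (Vecₚ.lookup-++ˡ A (concat Bs) u))

      lookup-pendant : ∀ v a → lookup (A ++ concat Bs) (pendantVertex v a) ≡ lookup (lookup Bs v) a
      lookup-pendant v a = trans (Vecₚ.lookup-++ʳ A (concat Bs) (combine v a)) (Vecₚ.lookup-concat Bs v a)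

      pendant∈ : ∀ {v a} → a ∈ᵥ lookup Bs v → pendantVertex v a ∈ᵥ (A ++ concat Bs)
      pendant∈ {v} {a} = trans (lookup-pendant v a)

      pendant∈⁻ : ∀ {v a} → pendantVertex v a ∈ᵥ (A ++ concat Bs) → a ∈ᵥ lookup Bs v
      pendant∈⁻ {v} {a} = trans (sym (lookup-pendant v a))

      Independent-corona⇔ : Independent (corona p G) (A ++ concat Bs) ⇔
                            (Independent G A × (∀ v → Compatible (lookup A v) (lookup Bs v)))
      Independent-corona⇔ = mk⇔ to from
        where
        to : Independent (corona p G) (A ++ concat Bs) →
             Independent G A × (∀ v → Compatible (lookup A v) (lookup Bs v))
        to I = (λ u v u∈ v∈ → trans (sym (corona-base-base u v)) (I _ _ (base∈ u∈) (base∈ v∈)))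
             , λ v a a∈ →
                 ¬-not (λ v∈ → independent-adjacent (A ++ concat Bs) I (base-adjacent-pendant v a)
                                                    (base∈ v∈) (pendant∈ a∈))
               , λ b b∈ → decidable-stable (a Fin.≟ b)
                   (λ a≢b → independent-adjacent (A ++ concat Bs) I (clique-adjacent v a≢b)
                                                 (pendant∈ a∈) (pendant∈ b∈))

        from : Independent G A × (∀ v → Compatible (lookup A v) (lookup Bs v)) →
               Independent (corona p G) (A ++ concat Bs)
        from (IA , comp) x y x∈ y∈ with vertexView x | vertexView y
        ... | base u | base v = trans (corona-base-base u v) (IA u v (base∈⁻ x∈) (base∈⁻ y∈))
        ... | base u | pendant v a = trans (corona-base-pendant u v a) (dec-false (u Fin.≟ v)
              λ { refl → contradiction (base∈⁻ x∈) (not-¬ (proj₁ (comp u a (pendant∈⁻ y∈)))) })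
        ... | pendant u a | base v = trans (corona-pendant-base u a v) (dec-false (u Fin.≟ v)
              λ { refl → contradiction (base∈⁻ y∈) (not-¬ (proj₁ (comp u a (pendant∈⁻ x∈)))) })
        ... | pendant u a | pendant v b =
              pendants-nonadjacent u a v b λ { refl → proj₂ (comp u a (pendant∈⁻ x∈)) b (pendant∈⁻ y∈) }

      independentᵇ-corona : independentᵇ (corona p G) (A ++ concat Bs) ≡ independentᵇ G A ∧ compatiblesᵇ A Bs
      independentᵇ-corona = ⇔→≡ (⇔-trans (independentᵇ⇔Independent (corona p G) (A ++ concat Bs))
        (⇔-trans Independent-corona⇔
                 (⇔-sym (⇔-trans ∧≡true⇔ (independentᵇ⇔Independent G A ×-⇔ compatiblesᵇ⇔Compatible A Bs)))))

      pendant-insertable : ∀ v a → lookup A v ≡ false → Empty (lookup Bs v) →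
        Independent (corona p G) (A ++ concat Bs) → Independent (corona p G) ((A ++ concat Bs) [ pendantVertex v a ]≔ true)
      pendant-insertable v a v∉A empty I =
        Independent-[]≔ (corona p G) (A ++ concat Bs) _ I (pendants-nonadjacent v a v a (λ _ → refl)) separated
        where
        separated : ∀ y → y ∈ᵥ (A ++ concat Bs) →
                    corona p G (pendantVertex v a) y ≡ false × corona p G y (pendantVertex v a) ≡ false
        separated y y∈ with vertexView y
        ... | base u =
              trans (corona-pendant-base v a u) (dec-false (v Fin.≟ u) v≢u)
            , trans (corona-base-pendant u v a) (dec-false (u Fin.≟ v) (v≢u ∘ sym))
          where
          v≢u : v ≢ u
          v≢u refl = contradiction (trans (sym v∉A) (base∈⁻ y∈)) λ ()
        ... | pendant u b =
              pendants-nonadjacent v a u b (λ { refl → contradiction (pendant∈⁻ y∈) (empty b) })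
            , pendants-nonadjacent u b v a (λ { refl → contradiction (pendant∈⁻ y∈) (empty b) })

      compatibleᵇ-block : ∀ {v} x → lookup A v ≡ x → Compatible (lookup A v) (lookup Bs v) →
                          compatibleᵇ x (lookup Bs v) ≡ true
      compatibleᵇ-block {v} x refl = Equivalence.from (compatibleᵇ⇔Compatible x (lookup Bs v))

      block-size : ∀ E → (∀ v → ∃ λ a → ¬ E (pendantVertex v a)) → MaximalOutside (corona p G) E (A ++ concat Bs) →
                   ∀ v → iverson (lookup A v) + card (lookup Bs v) ≡ 1
      block-size E free (I , maximal) v with lookup A v in v∈A | Equivalence.to Independent-corona⇔ I
      ... | true  | _ , compatible =
            cong suc (<ᵇ1⇒≡0 _ (compatibleᵇ-block true v∈A (compatible v)))
      ... | false | _ , compatible with card (lookup Bs v) in size | compatibleᵇ-block false v∈A (compatible v)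
      ...   | 1           | _  = refl
      ...   | suc (suc _) | ()
      ...   | 0           | _  = contradiction
              (pendant-insertable v a v∈A empty I) (maximal (pendantVertex v a) a∉E (λ a∈ → empty a (pendant∈⁻ a∈)))
        where
        a = proj₁ (free v)
        a∉E = proj₂ (free v)
        empty : Empty (lookup Bs v)
        empty = card<1⇒Empty (lookup Bs v) (cong (_<ᵇ 1) size)

    open Homogenise p

    indepCoeff-corona : ∀ k → indepCoeff (corona p G) k ≡ homogenise n (indepCoeff G) k
    indepCoeff-corona k = begin
      indepCoeff (corona p G) k
        ≡⟨ indepCoeff≡subsetSum (corona p G) k ⟩
      subsetSum (n + n * p) (λ S → iverson (independentᵇ (corona p G) S) * iverson (card S ≡ᵇ k))
        ≡⟨ subsetSum-++ n _ ⟩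
      subsetSum n (λ A → subsetSum (n * p) (λ t →
        iverson (independentᵇ (corona p G) (A ++ t)) * iverson (card (A ++ t) ≡ᵇ k)))
        ≡⟨ subsetSum-cong n (λ A → subsetSum-concat n p _) ⟩
      subsetSum n (λ A → blockSum n (λ Bs →
        iverson (independentᵇ (corona p G) (A ++ concat Bs)) * iverson (card (A ++ concat Bs) ≡ᵇ k)))
        ≡⟨ subsetSum-cong n (λ A → trans (blockSum-cong n (split A)) (blockSum-*ˡ n (iverson (independentᵇ G A)) _)) ⟩
      subsetSum n (λ A → iverson (independentᵇ G A) * pendantCount p A 0 k)
        ≡⟨ subsetSum-cong n (λ A → cong (iverson (independentᵇ G A) *_) (pendantCount≡ p A 0 k)) ⟩
      subsetSum n (λ A → iverson (independentᵇ G A) * homogenise n (monomial (card A)) k)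
        ≡⟨ subsetSum-cong n (λ A → homogenise-scale n (iverson (independentᵇ G A)) (monomial (card A)) k) ⟨
      subsetSum n (λ A → homogenise n (scale (iverson (independentᵇ G A)) (monomial (card A))) k)
        ≡⟨ homogenise-subsetSum p n n (λ A → scale (iverson (independentᵇ G A)) (monomial (card A))) k ⟨
      homogenise n (λ j → subsetSum n (λ A → iverson (independentᵇ G A) * monomial (card A) j)) k
        ≡⟨ homogenise-cong n (λ j → trans (indepCoeff≡subsetSum G j)
             (subsetSum-cong n (λ A → cong (iverson (independentᵇ G A) *_) (iverson-≡ᵇ (card A) j)))) k ⟨
      homogenise n (indepCoeff G) k ∎
      where
      open ≡-Reasoning
      split : ∀ A Bs →
        iverson (independentᵇ (corona p G) (A ++ concat Bs)) * iverson (card (A ++ concat Bs) ≡ᵇ k) ≡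
        iverson (independentᵇ G A) * (iverson (compatiblesᵇ A Bs) * iverson (card A + card (concat Bs) ≡ᵇ k))
      split A Bs rewrite independentᵇ-corona A Bs | iverson-∧ (independentᵇ G A) (compatiblesᵇ A Bs)
                       | card-++ A (concat Bs) = ℕₚ.*-assoc (iverson (independentᵇ G A)) _ _

    maximalOutside-card : ∀ E → (∀ v → ∃ λ a → ¬ E (pendantVertex v a)) →
                          ∀ S → MaximalOutside (corona p G) E S → card S ≡ n
    maximalOutside-card E free S maximal with Vec.splitAt n S
    ... | A , t , refl with Vec.group n p t
    ...   | Bs , refl = trans (card-++ A (concat Bs)) (card-blocks A Bs (block-size A Bs E free maximal))

    corona-oneWellCovered : 1 ≤ n → 2 ≤ p → OneWellCovered (corona p G)
    corona-oneWellCovered (s≤s z≤n) 2≤p@(s≤s (s≤s _)) = oneWellCovered (corona p G) n 2≤size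
      (λ S S-max → maximalOutside-card (λ _ → ⊥) (λ _ → zero , λ ()) S (Maximal⇒MaximalOutside {S = S} _ S-max))
      (λ x → maximalOutside-card (_≡ x) (avoiding x))
      where
      2≤size : 2 ≤ n + n * p
      2≤size = ℕₚ.≤-trans 2≤p (ℕₚ.≤-trans (ℕₚ.m≤n*m p n) (ℕₚ.m≤n+m (n * p) n))
      avoiding : ∀ x v → ∃ λ a → pendantVertex v a ≢ x
      avoiding x v with pendantVertex v zero Fin.≟ x
      ... | no  ≢x = zero , ≢x
      ... | yes ≡x = suc zero , λ ≡x′ → Finₚ.0≢1+n (Finₚ.combine-injectiveʳ v zero v (suc zero)
                       (Finₚ.↑ʳ-injective n _ _ (trans ≡x (sym ≡x′))))

module Unimodality where

  open import Data.Nat using (_+_; _*_; _∸_; _<_; _≤?_)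
  import Data.Nat.Properties as ℕₚ
  open import Data.Sum using (_⊎_; inj₁; inj₂)
  open import Data.Empty using (⊥-elim)
  open import Relation.Nullary using (yes; no)
  open import Relation.Binary.PropositionalEquality

  module _ (a : ℕ → ℕ) (logConcave : ∀ i → a i * a (2 + i) ≤ a (1 + i) * a (1 + i))
           (zero-persists : ∀ i → a (1 + i) ≡ 0 → a (2 + i) ≡ 0) where

    descent-persists : ∀ i → a (1 + i) ≤ a i → a (2 + i) ≤ a (1 + i)
    descent-persists i aᵢ₊₁≤aᵢ with a (1 + i) in eq
    ... | zero  = ℕₚ.≤-reflexive (zero-persists i eq)
    ... | suc x = ℕₚ.*-cancelˡ-≤ (suc x) (begin
      suc x * a (2 + i)     ≤⟨ ℕₚ.*-monoˡ-≤ (a (2 + i)) aᵢ₊₁≤aᵢ ⟩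
      a i * a (2 + i)       ≤⟨ logConcave i ⟩
      a (1 + i) * a (1 + i) ≡⟨ cong₂ _*_ eq eq ⟩
      suc x * suc x         ∎)
      where open ℕₚ.≤-Reasoning

    descending-from : ∀ k → a (1 + k) ≤ a k → ∀ i → k ≤ i → a (1 + i) ≤ a i
    descending-from k aₖ₊₁≤aₖ i k≤i = subst (λ j → a (1 + j) ≤ a j) (ℕₚ.m∸n+n≡m k≤i) (descending (i ∸ k))
      where
      descending : ∀ d → a (1 + (d + k)) ≤ a (d + k)
      descending zero    = aₖ₊₁≤aₖ
      descending (suc d) = descent-persists (d + k) (descending d)

    first-descent : ∀ N → (∃ λ k → (∀ i → i < k → a i ≤ a (1 + i)) × a (1 + k) ≤ a k) ⊎
                          (∀ i → i ≤ N → a i < a (1 + i))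
    first-descent zero with a 1 ≤? a 0
    ... | yes a₁≤a₀ = inj₁ (0 , (λ _ ()) , a₁≤a₀)
    ... | no  a₁≰a₀ = inj₂ λ { zero _ → ℕₚ.≰⇒> a₁≰a₀ }
    first-descent (suc N) with first-descent N
    ... | inj₁ descent = inj₁ descent
    ... | inj₂ ascending with a (2 + N) ≤? a (1 + N)
    ...   | yes aₙ₊₂≤aₙ₊₁ = inj₁ (suc N , (λ i i<N+1 → ℕₚ.<⇒≤ (ascending i (ℕₚ.≤-pred i<N+1))) , aₙ₊₂≤aₙ₊₁)
    ...   | no  aₙ₊₂≰aₙ₊₁ = inj₂ λ i i≤N+1 → ascending′ i (ℕₚ.m≤n⇒m<n∨m≡n i≤N+1)
      where
      ascending′ : ∀ i → i < suc N ⊎ i ≡ suc N → a i < a (1 + i)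
      ascending′ i (inj₁ i<N+1) = ascending i (ℕₚ.≤-pred i<N+1)
      ascending′ _ (inj₂ refl)  = ℕₚ.≰⇒> aₙ₊₂≰aₙ₊₁

    logConcave⇒unimodal : ∀ d → a (1 + d) ≡ 0 → Unimodal a
    logConcave⇒unimodal d aₐ₊₁≡0 with first-descent d
    ... | inj₂ ascending = ⊥-elim (ℕₚ.n≮0 (subst (a d <_) aₐ₊₁≡0 (ascending d ℕₚ.≤-refl)))
    ... | inj₁ (k , ascending , aₖ₊₁≤aₖ) = k , ascending , descending-from k aₖ₊₁≤aₖ

module OrderedFieldProperties {c ℓ : Level} (R : RealClosedField c ℓ) where

  open import Level using (_⊔_)
  import Relation.Binary.Reasoning.Setoid
  open import Data.Sum using (_⊎_; inj₁; inj₂)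
  open import Data.Empty using (⊥-elim)
  open import Relation.Nullary using (¬_)
  import Data.Nat.Properties as ℕₚ
  import Relation.Binary.PropositionalEquality as ≡
  import Algebra.Properties.Ring as RingProperties

  open RealClosedField R public renaming (refl to ≈-refl; sym to ≈-sym; trans to ≈-trans)
  module ≈-Reasoning = Relation.Binary.Reasoning.Setoid setoid
  open import Algebra.Solver.Ring.NaturalCoefficients.Default commutativeSemiring public
    using (solve; _:+_; _:*_; _:=_)
  open RingProperties ring public using (-‿involutive; -‿distribˡ-*; -‿distribʳ-*; -1*x≈-x)

  NonNeg : Carrier → Set ℓ
  NonNeg x = 0# < x ⊎ 0# ≈ x

  infix 4 _≤ᵣ_
  _≤ᵣ_ : Carrier → Carrier → Set (c ⊔ ℓ)
  x ≤ᵣ y = ∃ λ d → NonNeg d × y ≈ x + d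

  <-irrefl-≈ : ∀ {x y} → x ≈ y → ¬ (x < y)
  <-irrefl-≈ {x} {y} x≈y x<y = <-irrefl y (<-respˡ-≈ x≈y x<y)

  0<1 : 0# < 1#
  0<1 with <-trichotomy 0# 1#
  ... | inj₁ 0<1       = 0<1
  ... | inj₂ (inj₁ 0≈1) = ⊥-elim (nontrivial 0≈1)
  ... | inj₂ (inj₂ 1<0) = ⊥-elim (<-irrefl 1# (<-trans 1<0 (<-respʳ-≈ sq (*-pos 0<-1 0<-1))))
    where
    0<-1 : 0# < - 1#
    0<-1 = <-respˡ-≈ (-‿inverseʳ 1#) (<-respʳ-≈ (+-identityˡ (- 1#)) (+-mono-< (- 1#) 1<0))
    sq : - 1# * - 1# ≈ 1#
    sq = ≈-trans (-1*x≈-x (- 1#)) (-‿involutive 1#)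

  x<x+d : ∀ x {d} → 0# < d → x < x + d
  x<x+d x {d} 0<d = <-respʳ-≈ (+-comm d x) (<-respˡ-≈ (+-identityˡ x) (+-mono-< x 0<d))

  0<y-x : ∀ {x y} → x < y → 0# < y + - x
  0<y-x {x} x<y = <-respˡ-≈ (-‿inverseʳ x) (+-mono-< (- x) x<y)

  x+[y-x]≈y : ∀ x y → x + (y + - x) ≈ y
  x+[y-x]≈y x y = begin
    x + (y + - x) ≈⟨ +-congˡ (+-comm y (- x)) ⟩
    x + (- x + y) ≈⟨ +-assoc x (- x) y ⟨
    x + - x + y   ≈⟨ +-congʳ (-‿inverseʳ x) ⟩
    0# + y        ≈⟨ +-identityˡ y ⟩
    y             ∎
    where open ≈-Reasoning

  neg-pos : ∀ {x} → x < 0# → 0# < - x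
  neg-pos {x} x<0 = <-respˡ-≈ (-‿inverseʳ x) (<-respʳ-≈ (+-identityˡ (- x)) (+-mono-< (- x) x<0))

  pos⇒nonzero : ∀ {x} → 0# < x → ¬ (x ≈ 0#)
  pos⇒nonzero 0<x x≈0 = <-irrefl-≈ (≈-sym x≈0) 0<x

  pos+nonNeg : ∀ {x y} → 0# < x → NonNeg y → 0# < x + y
  pos+nonNeg {x} 0<x (inj₁ 0<y) = <-trans 0<x (x<x+d x 0<y)
  pos+nonNeg {x} 0<x (inj₂ 0≈y) = <-respʳ-≈ (≈-trans (≈-sym (+-identityʳ x)) (+-congˡ 0≈y)) 0<x

  nonNeg-+ : ∀ {x y} → NonNeg x → NonNeg y → NonNeg (x + y)
  nonNeg-+ (inj₁ 0<x) y≥0 = inj₁ (pos+nonNeg 0<x y≥0)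
  nonNeg-+ {x} {y} (inj₂ 0≈x) (inj₁ 0<y) =
    inj₁ (<-respʳ-≈ (≈-trans (≈-sym (+-identityˡ y)) (+-congʳ 0≈x)) 0<y)
  nonNeg-+ (inj₂ 0≈x) (inj₂ 0≈y) = inj₂ (≈-trans (≈-sym (+-identityˡ 0#)) (+-cong 0≈x 0≈y))

  nonNeg-* : ∀ {x y} → NonNeg x → NonNeg y → NonNeg (x * y)
  nonNeg-* (inj₁ 0<x) (inj₁ 0<y)       = inj₁ (*-pos 0<x 0<y)
  nonNeg-* {x} {y} _ (inj₂ 0≈y)        = inj₂ (≈-trans (≈-sym (zeroʳ x)) (*-congˡ 0≈y))
  nonNeg-* {x} {y} (inj₂ 0≈x) (inj₁ _) = inj₂ (≈-trans (≈-sym (zeroˡ y)) (*-congʳ 0≈x))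

  nonNeg-resp : ∀ {x y} → x ≈ y → NonNeg x → NonNeg y
  nonNeg-resp x≈y (inj₁ 0<x) = inj₁ (<-respʳ-≈ x≈y 0<x)
  nonNeg-resp x≈y (inj₂ 0≈x) = inj₂ (≈-trans 0≈x x≈y)

  ≈0⇒≤ᵣ : ∀ {x y} → x ≈ 0# → NonNeg y → x ≤ᵣ y
  ≈0⇒≤ᵣ {x} {y} x≈0 y≥0 = y , y≥0 , ≈-trans (≈-sym (+-identityˡ y)) (+-congʳ (≈-sym x≈0))

  nonNeg-square : ∀ x → NonNeg (x * x)
  nonNeg-square x with <-trichotomy 0# x
  ... | inj₁ 0<x        = inj₁ (*-pos 0<x 0<x)
  ... | inj₂ (inj₁ 0≈x) = nonNeg-* (inj₂ 0≈x) (inj₂ 0≈x)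
  ... | inj₂ (inj₂ x<0) = inj₁ (<-respʳ-≈ -x*-x≈x*x (*-pos (neg-pos x<0) (neg-pos x<0)))
    where
    -x*-x≈x*x : - x * - x ≈ x * x
    -x*-x≈x*x = ≈-trans (≈-sym (-‿distribˡ-* x (- x)))
                        (≈-trans (-‿cong (≈-sym (-‿distribʳ-* x x))) (-‿involutive (x * x)))

  ≤ᵣ-reflexive : ∀ {x y} → x ≈ y → x ≤ᵣ y
  ≤ᵣ-reflexive {x} x≈y = 0# , inj₂ ≈-refl , ≈-trans (≈-sym x≈y) (≈-sym (+-identityʳ x))

  ≤ᵣ-refl : ∀ x → x ≤ᵣ x
  ≤ᵣ-refl x = ≤ᵣ-reflexive ≈-refl

  <⇒≤ᵣ : ∀ {x y} → x < y → x ≤ᵣ y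
  <⇒≤ᵣ {x} {y} x<y = y + - x , inj₁ (0<y-x x<y) , ≈-sym (x+[y-x]≈y x y)

  ≤ᵣ-resp : ∀ {x x′ y y′} → x ≈ x′ → y ≈ y′ → x ≤ᵣ y → x′ ≤ᵣ y′
  ≤ᵣ-resp x≈x′ y≈y′ (d , d≥0 , y≈x+d) = d , d≥0 , ≈-trans (≈-sym y≈y′) (≈-trans y≈x+d (+-congʳ x≈x′))

  ≤ᵣ⇒≯ : ∀ {x y} → x ≤ᵣ y → ¬ (y < x)
  ≤ᵣ⇒≯ {x} (d , inj₁ 0<d , y≈x+d) y<x = <-irrefl x (<-trans (x<x+d x 0<d) (<-respˡ-≈ y≈x+d y<x))
  ≤ᵣ⇒≯ {x} (d , inj₂ 0≈d , y≈x+d) y<x =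
    <-irrefl-≈ (≈-trans y≈x+d (≈-trans (+-congˡ (≈-sym 0≈d)) (+-identityʳ x))) y<x

  *-monoˡ-< : ∀ {a x y} → 0# < a → x < y → a * x < a * y
  *-monoˡ-< {a} {x} {y} 0<a x<y = <-respʳ-≈ (≈-sym ay≈ax+a[y-x]) (x<x+d (a * x) (*-pos 0<a (0<y-x x<y)))
    where
    ay≈ax+a[y-x] : a * y ≈ a * x + a * (y + - x)
    ay≈ax+a[y-x] = ≈-trans (*-congˡ (≈-sym (x+[y-x]≈y x y))) (distribˡ a x (y + - x))

  *-mono-≤ᵣ : ∀ {x₁ y₁ x₂ y₂} → NonNeg x₁ → NonNeg x₂ → x₁ ≤ᵣ y₁ → x₂ ≤ᵣ y₂ → x₁ * x₂ ≤ᵣ y₁ * y₂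
  *-mono-≤ᵣ {x₁} {y₁} {x₂} {y₂} x₁≥0 x₂≥0 (d₁ , d₁≥0 , e₁) (d₂ , d₂≥0 , e₂) =
    x₁ * d₂ + d₁ * x₂ + d₁ * d₂ ,
    nonNeg-+ (nonNeg-+ (nonNeg-* x₁≥0 d₂≥0) (nonNeg-* d₁≥0 x₂≥0)) (nonNeg-* d₁≥0 d₂≥0) ,
    ≈-trans (*-cong e₁ e₂) (expand x₁ x₂ d₁ d₂)
    where
    expand : ∀ a b c d → (a + c) * (b + d) ≈ a * b + (a * d + c * b + c * d)
    expand = solve 4 (λ a b c d → (a :+ c) :* (b :+ d) := a :* b :+ (a :* d :+ c :* b :+ c :* d)) ≈-refl

  *-cancelˡ-≤ᵣ : ∀ {w z} → 0# < w → w * z ≤ᵣ w * w → z ≤ᵣ w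
  *-cancelˡ-≤ᵣ {w} {z} 0<w wz≤ww with <-trichotomy z w
  ... | inj₁ z<w        = <⇒≤ᵣ z<w
  ... | inj₂ (inj₁ z≈w) = ≤ᵣ-reflexive z≈w
  ... | inj₂ (inj₂ w<z) = ⊥-elim (≤ᵣ⇒≯ wz≤ww (*-monoˡ-< 0<w w<z))

  fromℕ-nonNeg : ∀ k → NonNeg (fromℕ k)
  fromℕ-nonNeg zero    = inj₂ ≈-refl
  fromℕ-nonNeg (suc k) = inj₁ (pos+nonNeg 0<1 (fromℕ-nonNeg k))

  fromℕ-pos : ∀ k → 0# < fromℕ (suc k)
  fromℕ-pos k = pos+nonNeg 0<1 (fromℕ-nonNeg k)

  fromℕ-+ : ∀ m n → fromℕ (m ℕ.+ n) ≈ fromℕ m + fromℕ n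
  fromℕ-+ zero    n = ≈-sym (+-identityˡ (fromℕ n))
  fromℕ-+ (suc m) n = ≈-trans (+-congˡ (fromℕ-+ m n)) (≈-sym (+-assoc 1# (fromℕ m) (fromℕ n)))

  fromℕ-* : ∀ m n → fromℕ (m ℕ.* n) ≈ fromℕ m * fromℕ n
  fromℕ-* zero    n = ≈-sym (zeroˡ (fromℕ n))
  fromℕ-* (suc m) n = begin
    fromℕ (n ℕ.+ m ℕ.* n)         ≈⟨ ≈-trans (fromℕ-+ n (m ℕ.* n)) (+-congˡ (fromℕ-* m n)) ⟩
    fromℕ n + fromℕ m * fromℕ n   ≈⟨ +-congʳ (*-identityˡ (fromℕ n)) ⟨
    1# * fromℕ n + fromℕ m * fromℕ n ≈⟨ distribʳ (fromℕ n) 1# (fromℕ m) ⟨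
    (1# + fromℕ m) * fromℕ n      ∎
    where open ≈-Reasoning

  fromℕ-cancel-≤ : ∀ {m n} → fromℕ m ≤ᵣ fromℕ n → m ℕ.≤ n
  fromℕ-cancel-≤ {m} {n} fm≤fn with ℕₚ.≤-<-connex m n
  ... | inj₁ m≤n = m≤n
  ... | inj₂ n<m with ℕₚ.m≤n⇒∃[o]m+o≡n n<m
  ...   | d , n+1+d≡m = ⊥-elim (≤ᵣ⇒≯ fm≤fn (<-respʳ-≈ fn+[1+d]≈fm (x<x+d (fromℕ n) (fromℕ-pos d))))
    where
    fn+[1+d]≈fm : fromℕ n + fromℕ (suc d) ≈ fromℕ m
    fn+[1+d]≈fm = ≈-trans (≈-sym (fromℕ-+ n (suc d))) (reflexive (≡.cong fromℕ (≡.trans (ℕₚ.+-suc n d) n+1+d≡m)))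

  fromℕ≈0⇒≡0 : ∀ {m} → fromℕ m ≈ 0# → m ≡.≡ 0
  fromℕ≈0⇒≡0 {zero}  _      = ≡.refl
  fromℕ≈0⇒≡0 {suc m} fm≈0 = ⊥-elim (pos⇒nonzero (fromℕ-pos m) fm≈0)

  -- Reciprocals, with the junk value 0⁻¹ = 0.

  _⁻¹ : Carrier → Carrier
  x ⁻¹ with <-trichotomy x 0#
  ... | inj₁ x<0        = proj₁ (inverse x (λ x≈0 → <-irrefl-≈ x≈0 x<0))
  ... | inj₂ (inj₁ _)   = 0#
  ... | inj₂ (inj₂ 0<x) = proj₁ (inverse x (pos⇒nonzero 0<x))

  *-inverseʳ : ∀ x → ¬ (x ≈ 0#) → x * x ⁻¹ ≈ 1#
  *-inverseʳ x x≉0 with <-trichotomy x 0#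
  ... | inj₁ x<0        = proj₂ (inverse x (λ x≈0 → <-irrefl-≈ x≈0 x<0))
  ... | inj₂ (inj₁ x≈0) = ⊥-elim (x≉0 x≈0)
  ... | inj₂ (inj₂ 0<x) = proj₂ (inverse x (pos⇒nonzero 0<x))

  nonzero-* : ∀ {x y} → ¬ (x ≈ 0#) → ¬ (y ≈ 0#) → ¬ (x * y ≈ 0#)
  nonzero-* {x} {y} x≉0 y≉0 xy≈0 = x≉0 (begin
    x                  ≈⟨ *-identityʳ x ⟨
    x * 1#             ≈⟨ *-congˡ (*-inverseʳ y y≉0) ⟨
    x * (y * y ⁻¹)     ≈⟨ *-assoc x y (y ⁻¹) ⟨
    (x * y) * y ⁻¹     ≈⟨ *-congʳ xy≈0 ⟩
    0# * y ⁻¹          ≈⟨ zeroˡ _ ⟩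
    0#                 ∎)
    where open ≈-Reasoning

module LinearFactors {c ℓ : Level} (R : RealClosedField c ℓ) where

  open import Data.Sum using (inj₁; inj₂)
  open import Data.Empty using (⊥-elim)
  open import Relation.Nullary using (¬_)
  open import Data.List as List using (List; []; _∷_; length)
  open import Data.List.Membership.Propositional using (_∈_)
  import Data.List.Membership.Propositional.Properties as ∈ₚ
  open import Data.List.Relation.Unary.Any using (here; there)
  open import Data.List.Relation.Unary.All as All using (All)
  open import Function using (case_of_)
  import Data.Nat.Properties as ℕₚ
  import Relation.Binary.PropositionalEquality as ≡

  open OrderedFieldProperties R
  open Sequences commutativeSemiring public

  linear : Carrier → Seq → Seq
  linear a q = shift q ⊕ scale a q

  prodLinear : List Carrier → Seq
  prodLinear []       = one
  prodLinear (a ∷ as) = linear a (prodLinear as)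

  linear-cong : ∀ a {f g} → f ≋ g → linear a f ≋ linear a g
  linear-cong a f≋g = ⊕-cong (shift-cong f≋g) (scale-cong a f≋g)

  linear-congˡ : ∀ {a b} q → a ≈ b → linear a q ≋ linear b q
  linear-congˡ q a≈b = ⊕-cong ≋-refl (scale-congˡ q a≈b)

  prodLinear-degree : ∀ as → Degree≤ (length as) (prodLinear as)
  prodLinear-degree []       (suc i) _ = ≈-refl
  prodLinear-degree (a ∷ as) (suc i) (s≤s d<i) =
    ≈-trans (+-cong (prodLinear-degree as i d<i)
                    (≈-trans (*-congˡ (prodLinear-degree as (suc i) (ℕₚ.m<n⇒m<1+n d<i))) (zeroʳ a)))
            (+-identityˡ 0#)

  prodLinear-leading : ∀ as → prodLinear as (length as) ≈ 1#
  prodLinear-leading []       = ≈-refl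
  prodLinear-leading (a ∷ as) =
    ≈-trans (+-cong (prodLinear-leading as) (≈-trans (*-congˡ (prodLinear-degree as (suc (length as)) ℕₚ.≤-refl)) (zeroʳ a)))
            (+-identityʳ 1#)

  prodLinear-neg-neg : ∀ as → prodLinear (List.map -_ (List.map -_ as)) ≋ prodLinear as
  prodLinear-neg-neg []       = ≋-refl
  prodLinear-neg-neg (a ∷ as) = ≋-trans (linear-cong _ (prodLinear-neg-neg as)) (linear-congˡ (prodLinear as) (-‿involutive a))

  coeff-addP : ∀ f g k → coeff (addP f g) k ≈ coeff f k + coeff g k
  coeff-addP []      g       k       = ≈-sym (+-identityˡ _)
  coeff-addP (a ∷ f) []      zero    = ≈-sym (+-identityʳ a)
  coeff-addP (a ∷ f) []      (suc k) = ≈-sym (+-identityʳ _)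
  coeff-addP (a ∷ f) (b ∷ g) zero    = ≈-refl
  coeff-addP (a ∷ f) (b ∷ g) (suc k) = coeff-addP f g k

  coeff-scale : ∀ a f k → coeff (List.map (a *_) f) k ≈ a * coeff f k
  coeff-scale a []      k       = ≈-sym (zeroʳ a)
  coeff-scale a (b ∷ f) zero    = ≈-refl
  coeff-scale a (b ∷ f) (suc k) = coeff-scale a f k

  coeff-shift : ∀ f k → coeff (0# ∷ f) k ≈ shift (coeff f) k
  coeff-shift f zero    = ≈-refl
  coeff-shift f (suc k) = ≈-refl

  coeff-prodLin : ∀ rs → coeff (prodLin rs) ≋ prodLinear (List.map -_ rs)
  coeff-prodLin []       zero          = ≈-refl
  coeff-prodLin []       (suc zero)    = ≈-refl
  coeff-prodLin []       (suc (suc k)) = ≈-refl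
  coeff-prodLin (r ∷ rs) k =
    ≈-trans (coeff-addP (0# ∷ prodLin rs) (List.map ((- r) *_) (prodLin rs)) k)
            (+-cong (≈-trans (coeff-shift (prodLin rs) k) (shift-cong (coeff-prodLin rs) k))
                    (≈-trans (coeff-scale (- r) (prodLin rs) k) (*-congˡ (coeff-prodLin rs k))))

  eval-addP : ∀ f g x → eval (addP f g) x ≈ eval f x + eval g x
  eval-addP []      g       x = ≈-sym (+-identityˡ _)
  eval-addP (a ∷ f) []      x = ≈-sym (+-identityʳ _)
  eval-addP (a ∷ f) (b ∷ g) x =
    ≈-trans (+-congˡ (≈-trans (*-congˡ (eval-addP f g x)) (distribˡ x _ _))) (interchange a b (x * eval f x) (x * eval g x))
    where
    interchange : ∀ a b c d → a + b + (c + d) ≈ a + c + (b + d)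
    interchange = solve 4 (λ a b c d → a :+ b :+ (c :+ d) := a :+ c :+ (b :+ d)) ≈-refl

  eval-scale : ∀ a f x → eval (List.map (a *_) f) x ≈ a * eval f x
  eval-scale a []      x = ≈-sym (zeroʳ a)
  eval-scale a (b ∷ f) x = ≈-trans (+-congˡ (*-congˡ (eval-scale a f x))) (factor a b x (eval f x))
    where
    factor : ∀ a b x e → a * b + x * (a * e) ≈ a * (b + x * e)
    factor = solve 4 (λ a b x e → a :* b :+ x :* (a :* e) := a :* (b :+ x :* e)) ≈-refl

  eval-mulLin : ∀ r f x → eval (mulLin r f) x ≈ (x + - r) * eval f x
  eval-mulLin r f x = begin
    eval (addP (0# ∷ f) (List.map ((- r) *_) f)) x ≈⟨ eval-addP (0# ∷ f) (List.map ((- r) *_) f) x ⟩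
    0# + x * eval f x + eval (List.map ((- r) *_) f) x ≈⟨ +-cong (+-identityˡ _) (eval-scale (- r) f x) ⟩
    x * eval f x + - r * eval f x ≈⟨ distribʳ (eval f x) x (- r) ⟨
    (x + - r) * eval f x ∎
    where open ≈-Reasoning

  eval-prodLin-root : ∀ rs {r} → r ∈ rs → eval (prodLin rs) r ≈ 0#
  eval-prodLin-root (r ∷ rs) (here ≡.refl) =
    ≈-trans (eval-mulLin r (prodLin rs) r) (≈-trans (*-congʳ (-‿inverseʳ r)) (zeroˡ _))
  eval-prodLin-root (s ∷ rs) {r} (there r∈rs) =
    ≈-trans (eval-mulLin s (prodLin rs) r) (≈-trans (*-congˡ (eval-prodLin-root rs r∈rs)) (zeroʳ _))

  eval-nonNeg : ∀ f x → (∀ k → NonNeg (coeff f k)) → NonNeg x → NonNeg (eval f x)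
  eval-nonNeg []      x f≥0 x≥0 = inj₂ ≈-refl
  eval-nonNeg (a ∷ f) x f≥0 x≥0 = nonNeg-+ (f≥0 0) (nonNeg-* x≥0 (eval-nonNeg f x (f≥0 ∘ suc) x≥0))

  eval-pos : ∀ f x → (∀ k → NonNeg (coeff f k)) → 0# < coeff f 0 → NonNeg x → 0# < eval f x
  eval-pos []      x f≥0 0<f₀ x≥0 = 0<f₀
  eval-pos (a ∷ f) x f≥0 0<f₀ x≥0 = pos+nonNeg 0<f₀ (nonNeg-* x≥0 (eval-nonNeg f x (f≥0 ∘ suc) x≥0))

  module _ (a : ℕ → ℕ) (lc : Carrier) (rs : List Carrier)
           (a≈ : ∀ i → fromℕ (a i) ≈ lc * coeff (prodLin rs) i) (a₀≡1 : a 0 ≡.≡ 1) where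

    -- A polynomial with nonnegative coefficients and positive constant term is positive on [0, ∞).
    root-not-nonNeg : ∀ {r} → r ∈ rs → ¬ NonNeg r
    root-not-nonNeg {r} r∈rs r≥0 = <-irrefl-≈ (≈-sym f[r]≈0)
      (eval-pos f r (λ k → nonNeg-resp (≈-sym (f≈a k)) (fromℕ-nonNeg (a k)))
                    (<-respʳ-≈ (≈-sym (≈-trans (f≈a 0) (reflexive (≡.cong fromℕ a₀≡1)))) (fromℕ-pos 0)) r≥0)
      where
      f = List.map (lc *_) (prodLin rs)
      f≈a : ∀ k → coeff f k ≈ fromℕ (a k)
      f≈a k = ≈-trans (coeff-scale lc (prodLin rs) k) (≈-sym (a≈ k))
      f[r]≈0 : eval f r ≈ 0#
      f[r]≈0 = ≈-trans (eval-scale lc (prodLin rs) r) (≈-trans (*-congˡ (eval-prodLin-root rs r∈rs)) (zeroʳ lc))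

    roots-negative : ∀ {r} → r ∈ rs → r < 0#
    roots-negative {r} r∈rs with <-trichotomy r 0#
    ... | inj₁ r<0        = r<0
    ... | inj₂ (inj₁ r≈0) = ⊥-elim (root-not-nonNeg r∈rs (inj₂ (≈-sym r≈0)))
    ... | inj₂ (inj₂ 0<r) = ⊥-elim (root-not-nonNeg r∈rs (inj₁ 0<r))

    negatedRoots-pos : All (0# <_) (List.map -_ rs)
    negatedRoots-pos = All.tabulate λ a∈ → case ∈ₚ.∈-map⁻ -_ a∈ of λ where
      (r , r∈rs , ≡.refl) → neg-pos (roots-negative r∈rs)

module HomogenisedFactors {c ℓ : Level} (R : RealClosedField c ℓ) (p : RealClosedField.Carrier R) where

  open import Data.Nat using (_∸_)
  open import Relation.Nullary using (¬_)
  import Relation.Binary.PropositionalEquality as ≡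
  open import Data.List as List using (List; []; _∷_; length; _++_)
  open import Data.List.Relation.Unary.All using (All; []; _∷_)
  import Data.Nat.Properties as ℕₚ

  open OrderedFieldProperties R
  open LinearFactors R
  open Homogenise p public

  homLinear : Carrier → Seq → Seq
  homLinear a q = shift q ⊕ scale a (mul1+px q)

  homProdLinear : List Carrier → Seq → Seq
  homProdLinear []       q = q
  homProdLinear (a ∷ as) q = homLinear a (homProdLinear as q)

  homLinear-cong : ∀ a {f g} → f ≋ g → homLinear a f ≋ homLinear a g
  homLinear-cong a f≋g = ⊕-cong (shift-cong f≋g) (scale-cong a (mul1+px-cong f≋g))

  homProdLinear-cong : ∀ as {f g} → f ≋ g → homProdLinear as f ≋ homProdLinear as g
  homProdLinear-cong []       f≋g = f≋g
  homProdLinear-cong (a ∷ as) f≋g = homLinear-cong a (homProdLinear-cong as f≋g)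

  homogenise-linear : ∀ m a g → Degree≤ m g → homogenise (suc m) (linear a g) ≋ homLinear a (homogenise m g)
  homogenise-linear m a g deg = begin
    homogenise (suc m) (shift g ⊕ scale a g)                       ≈⟨ homogenise-⊕ (suc m) (shift g) (scale a g) ⟩
    homogenise (suc m) (shift g) ⊕ homogenise (suc m) (scale a g)
      ≈⟨ ⊕-cong (homogenise-shift m g) (homogenise-scale (suc m) a g) ⟩
    shift (homogenise m g) ⊕ scale a (homogenise (suc m) g)
      ≈⟨ ⊕-cong ≋-refl (scale-cong a (homogenise-suc m g deg)) ⟩
    homLinear a (homogenise m g)                                   ∎
    where open ≋-Reasoning

  homogenise-prodLinear : ∀ as e → homogenise (length as ℕ.+ e) (prodLinear as) ≋ homProdLinear as (pow1+px e)
  homogenise-prodLinear []       e = homogenise-one e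
  homogenise-prodLinear (a ∷ as) e =
    ≋-trans (homogenise-linear (length as ℕ.+ e) a (prodLinear as)
               (Degree≤-mono (prodLinear as) (ℕₚ.m≤m+n (length as) e) (prodLinear-degree as)))
            (homLinear-cong a (homogenise-prodLinear as e))

  linear-scale : ∀ a k q → linear a (scale k q) ≋ scale k (linear a q)
  linear-scale a k q i = ≈-trans (+-congʳ (shift-scale k q i)) (swap k (shift q i) a (q i))
    where
    swap : ∀ k s a x → k * s + a * (k * x) ≈ k * (s + a * x)
    swap = solve 4 (λ k s a x → k :* s :+ a :* (k :* x) := k :* (s :+ a :* x)) ≈-refl

  homLinear-monic : ∀ a q → ¬ (1# + a * p ≈ 0#) →
                    homLinear a q ≋ scale (1# + a * p) (linear (a * (1# + a * p) ⁻¹) q)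
  homLinear-monic a q κ≉0 k = ≈-sym (begin
    κ * (s + (a * κ⁻¹) * x)     ≈⟨ regroup κ s a κ⁻¹ x ⟩
    κ * s + a * ((κ * κ⁻¹) * x) ≈⟨ +-congˡ (*-congˡ (≈-trans (*-congʳ (*-inverseʳ κ κ≉0)) (*-identityˡ x))) ⟩
    κ * s + a * x               ≈⟨ +-congʳ (≈-trans (distribʳ s 1# (a * p)) (+-congʳ (*-identityˡ s))) ⟩
    s + (a * p) * s + a * x     ≈⟨ regroup′ s a p x ⟩
    s + a * (x + p * s)         ∎)
    where
    κ = 1# + a * p
    κ⁻¹ = κ ⁻¹
    s = shift q k
    x = q k
    open ≈-Reasoning
    regroup : ∀ κ s a i x → κ * (s + (a * i) * x) ≈ κ * s + a * ((κ * i) * x)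
    regroup = solve 5 (λ κ s a i x → κ :* (s :+ (a :* i) :* x) := κ :* s :+ a :* ((κ :* i) :* x)) ≈-refl
    regroup′ : ∀ s a p x → s + (a * p) * s + a * x ≈ s + a * (x + p * s)
    regroup′ = solve 4 (λ s a p x → s :+ (a :* p) :* s :+ a :* x := s :+ a :* (x :+ p :* s)) ≈-refl

  mul1+px-monic : ¬ (p ≈ 0#) → ∀ q → mul1+px q ≋ scale p (linear (p ⁻¹) q)
  mul1+px-monic p≉0 q k = ≈-sym (begin
    p * (s + p ⁻¹ * x)      ≈⟨ distribˡ p s (p ⁻¹ * x) ⟩
    p * s + p * (p ⁻¹ * x)  ≈⟨ +-congˡ (*-assoc p (p ⁻¹) x) ⟨
    p * s + p * p ⁻¹ * x    ≈⟨ +-congˡ (≈-trans (*-congʳ (*-inverseʳ p p≉0)) (*-identityˡ x)) ⟩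
    p * s + x               ≈⟨ +-comm (p * s) x ⟩
    x + p * s               ∎)
    where
    s = shift q k
    x = q k
    open ≈-Reasoning

  pow1+px-monic : ¬ (p ≈ 0#) → ∀ e → pow1+px e ≋ scale (pow p e) (prodLinear (List.replicate e (p ⁻¹)))
  pow1+px-monic p≉0 zero    k = ≈-sym (*-identityˡ (one k))
  pow1+px-monic p≉0 (suc e) = begin
    mul1+px (pow1+px e)                         ≈⟨ mul1+px-cong (pow1+px-monic p≉0 e) ⟩
    mul1+px (scale (pow p e) Lₑ)                ≈⟨ mul1+px-scale (pow p e) Lₑ ⟩
    scale (pow p e) (mul1+px Lₑ)                ≈⟨ scale-cong (pow p e) (mul1+px-monic p≉0 Lₑ) ⟩
    scale (pow p e) (scale p (linear (p ⁻¹) Lₑ)) ≈⟨ scale-scale (pow p e) p _ ⟩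
    scale (pow p e * p) (linear (p ⁻¹) Lₑ)      ≈⟨ scale-congˡ _ (*-comm (pow p e) p) ⟩
    scale (pow p (suc e)) (linear (p ⁻¹) Lₑ)    ∎
    where
    Lₑ = prodLinear (List.replicate e (p ⁻¹))
    open ≋-Reasoning

  κ : Carrier → Carrier
  κ a = 1# + a * p

  κ-product : List Carrier → Carrier
  κ-product []       = 1#
  κ-product (a ∷ as) = κ a * κ-product as

  monicRoots : List Carrier → List Carrier
  monicRoots = List.map (λ a → a * κ a ⁻¹)

  homProdLinear-monic : ∀ as → All (λ a → ¬ (κ a ≈ 0#)) as → ∀ k L →
    homProdLinear as (scale k (prodLinear L)) ≋ scale (κ-product as * k) (prodLinear (monicRoots as ++ L))
  homProdLinear-monic []       []           k L = scale-congˡ _ (≈-sym (*-identityˡ k))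
  homProdLinear-monic (a ∷ as) (κ≉0 ∷ κs≉0) k L = begin
    homLinear a (homProdLinear as (scale k (prodLinear L)))        ≈⟨ homLinear-cong a (homProdLinear-monic as κs≉0 k L) ⟩
    homLinear a (scale K (prodLinear L′))                          ≈⟨ homLinear-monic a _ κ≉0 ⟩
    scale (κ a) (linear (a * κ a ⁻¹) (scale K (prodLinear L′)))    ≈⟨ scale-cong (κ a) (linear-scale _ K _) ⟩
    scale (κ a) (scale K (linear (a * κ a ⁻¹) (prodLinear L′)))    ≈⟨ scale-scale (κ a) K _ ⟩
    scale (κ a * K) (prodLinear (monicRoots (a ∷ as) ++ L))        ≈⟨ scale-congˡ _ (*-assoc (κ a) (κ-product as) k) ⟨
    scale (κ-product (a ∷ as) * k) (prodLinear (monicRoots (a ∷ as) ++ L)) ∎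
    where
    K = κ-product as * k
    L′ = monicRoots as ++ L
    open ≋-Reasoning

  homogenise-prodLinear-monic : ¬ (p ≈ 0#) → ∀ n lc as → All (λ a → ¬ (κ a ≈ 0#)) as → length as ≤ n →
    homogenise n (scale lc (prodLinear as)) ≋
    scale (lc * (κ-product as * pow p (n ∸ length as)))
          (prodLinear (monicRoots as ++ List.replicate (n ∸ length as) (p ⁻¹)))
  homogenise-prodLinear-monic p≉0 n lc as κs≉0 d≤n = begin
    homogenise n (scale lc (prodLinear as))                      ≈⟨ homogenise-scale n lc (prodLinear as) ⟩
    scale lc (homogenise n (prodLinear as))
      ≈⟨ scale-cong lc (≡⇒≋ (≡.cong (λ m → homogenise m (prodLinear as)) (ℕₚ.m+[n∸m]≡n d≤n))) ⟨
    scale lc (homogenise (length as ℕ.+ e) (prodLinear as))      ≈⟨ scale-cong lc (homogenise-prodLinear as e) ⟩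
    scale lc (homProdLinear as (pow1+px e))                      ≈⟨ scale-cong lc (homProdLinear-cong as (pow1+px-monic p≉0 e)) ⟩
    scale lc (homProdLinear as (scale (pow p e) (prodLinear (List.replicate e (p ⁻¹)))))
      ≈⟨ scale-cong lc (homProdLinear-monic as κs≉0 (pow p e) _) ⟩
    scale lc (scale (κ-product as * pow p e) (prodLinear (monicRoots as ++ List.replicate e (p ⁻¹))))
      ≈⟨ scale-scale lc _ _ ⟩
    scale (lc * (κ-product as * pow p e)) (prodLinear (monicRoots as ++ List.replicate e (p ⁻¹))) ∎
    where
    e = n ∸ length as
    open ≋-Reasoning

module CoronaRealRooted {c ℓ : Level} (R : RealClosedField c ℓ) (p : ℕ) where

  open import Data.Nat using (_∸_)
  open import Data.List as List using (List; []; _∷_; length; _++_)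
  open import Data.List.Relation.Unary.All as All using (All)
  open import Relation.Nullary using (¬_)
  import Data.Nat.Properties as ℕₚ
  import Relation.Binary.PropositionalEquality as ≡

  open OrderedFieldProperties R
  open LinearFactors R
  open HomogenisedFactors R (fromℕ p)
  open IndependentSets using (indepCoeff-zero; indepCoeff-beyond; module Corona)
  module ℕSequences = Sequences ℕₚ.+-*-commutativeSemiring
  module ℕHomogenise = ℕSequences.Homogenise p

  fromℕ-shift : ∀ f k → fromℕ (ℕSequences.shift f k) ≈ shift (fromℕ ∘ f) k
  fromℕ-shift f zero    = ≈-refl
  fromℕ-shift f (suc k) = ≈-refl

  fromℕ-one : ∀ k → fromℕ (ℕSequences.one k) ≈ one k
  fromℕ-one zero    = +-identityʳ 1#
  fromℕ-one (suc k) = ≈-refl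

  fromℕ-mul1+px : ∀ {f g} → (∀ k → fromℕ (f k) ≈ g k) → ∀ k → fromℕ (ℕHomogenise.mul1+px f k) ≈ mul1+px g k
  fromℕ-mul1+px {f} f≈g k =
    ≈-trans (fromℕ-+ (f k) _) (+-cong (f≈g k) (≈-trans (fromℕ-* p _)
      (*-congˡ (≈-trans (fromℕ-shift f k) (shift-cong f≈g k)))))

  fromℕ-pow1+px : ∀ m k → fromℕ (ℕHomogenise.pow1+px m k) ≈ pow1+px m k
  fromℕ-pow1+px zero    = fromℕ-one
  fromℕ-pow1+px (suc m) = fromℕ-mul1+px {ℕHomogenise.pow1+px m} (fromℕ-pow1+px m)

  fromℕ-homogenise : ∀ m f k → fromℕ (ℕHomogenise.homogenise m f k) ≈ homogenise m (fromℕ ∘ f) k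
  fromℕ-homogenise zero    f k = ≈-trans (fromℕ-* (f 0) _) (*-congˡ (fromℕ-one k))
  fromℕ-homogenise (suc m) f k =
    ≈-trans (fromℕ-+ (f 0 ℕ.* _) _)
            (+-cong (≈-trans (fromℕ-* (f 0) _) (*-congˡ (fromℕ-pow1+px (suc m) k)))
                    (≈-trans (fromℕ-shift _ k) (shift-cong (fromℕ-homogenise m (f ∘ suc)) k)))

  p-pos : 1 ℕ.≤ p → 0# < fromℕ p
  p-pos (s≤s {n = k} _) = fromℕ-pos k

  κ-pos : ∀ {a} → 1 ℕ.≤ p → 0# < a → 0# < κ a
  κ-pos 1≤p 0<a = pos+nonNeg 0<1 (inj₁ (*-pos 0<a (p-pos 1≤p)))
    where open import Data.Sum using (inj₁)

  κ-product-pos : ∀ {as} → 1 ℕ.≤ p → All (0# <_) as → 0# < κ-product as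
  κ-product-pos 1≤p All.[]           = 0<1
  κ-product-pos 1≤p (0<a All.∷ 0<as) = *-pos (κ-pos 1≤p 0<a) (κ-product-pos 1≤p 0<as)

  pow-pos : ∀ {x} → 0# < x → ∀ e → 0# < pow x e
  pow-pos 0<x zero    = 0<1
  pow-pos 0<x (suc e) = *-pos 0<x (pow-pos 0<x e)

  realRooted-corona : 1 ℕ.≤ p → ∀ {n} (G : Graph n) →
                      RealRooted R (indepCoeff G) → RealRooted R (indepCoeff (corona p G))
  realRooted-corona 1≤p {n} G (lc , rs , lc≉0 , s≈) = lc′ , List.map -_ L , lc′≉0 , s′≈
    where
    as = List.map -_ rs
    e = n ∸ length as
    L = monicRoots as ++ List.replicate e (fromℕ p ⁻¹)
    lc′ = lc * (κ-product as * pow (fromℕ p) e)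
    s≈lc·as : ∀ j → fromℕ (indepCoeff G j) ≈ lc * prodLinear as j
    s≈lc·as j = ≈-trans (s≈ j) (*-congˡ (coeff-prodLin rs j))
    as-pos : All (0# <_) as
    as-pos = negatedRoots-pos (indepCoeff G) lc rs s≈ (indepCoeff-zero G)
    d≤n : length as ℕ.≤ n
    d≤n = ℕₚ.≮⇒≥ λ n<d → lc≉0 (begin
      lc                              ≈⟨ *-identityʳ lc ⟨
      lc * 1#                         ≈⟨ *-congˡ (prodLinear-leading as) ⟨
      lc * prodLinear as (length as)  ≈⟨ s≈lc·as (length as) ⟨
      fromℕ (indepCoeff G (length as)) ≡⟨ ≡.cong fromℕ (indepCoeff-beyond G (length as) n<d) ⟩
      0#                              ∎)
      where open ≈-Reasoning
    lc′≉0 : ¬ (lc′ ≈ 0#)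
    lc′≉0 = nonzero-* lc≉0 (pos⇒nonzero (*-pos (κ-product-pos 1≤p as-pos) (pow-pos (p-pos 1≤p) e)))
    s′≈ : ∀ i → fromℕ (indepCoeff (corona p G) i) ≈ lc′ * coeff (prodLin (List.map -_ L)) i
    s′≈ i = begin
      fromℕ (indepCoeff (corona p G) i)                 ≡⟨ ≡.cong fromℕ (Corona.indepCoeff-corona p G i) ⟩
      fromℕ (ℕHomogenise.homogenise n (indepCoeff G) i) ≈⟨ fromℕ-homogenise n (indepCoeff G) i ⟩
      homogenise n (fromℕ ∘ indepCoeff G) i             ≈⟨ homogenise-cong n s≈lc·as i ⟩
      homogenise n (scale lc (prodLinear as)) i
        ≈⟨ homogenise-prodLinear-monic (pos⇒nonzero (p-pos 1≤p)) n lc as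
             (All.map (pos⇒nonzero ∘ κ-pos 1≤p) as-pos) d≤n i ⟩
      lc′ * prodLinear L i
        ≈⟨ *-congˡ (≈-trans (coeff-prodLin (List.map -_ L) i) (prodLinear-neg-neg L i)) ⟨
      lc′ * coeff (prodLin (List.map -_ L)) i           ∎
      where open ≈-Reasoning

module LogConcavity {c ℓ : Level} (R : RealClosedField c ℓ) where

  open import Level using (_⊔_)
  open import Data.Sum using (inj₁; inj₂)
  open import Data.Empty using (⊥-elim)
  open import Data.List as List using (List; []; _∷_; length)
  open import Data.List.Relation.Unary.All using (All; []; _∷_)
  open import Relation.Nullary using (yes; no)
  import Data.Nat.Properties as ℕₚ
  import Relation.Binary.PropositionalEquality as ≡

  open OrderedFieldProperties R
  open LinearFactors R
  open Unimodality using (logConcave⇒unimodal)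

  record PositiveLogConcave (b : Seq) (d : ℕ) : Set (c ⊔ ℓ) where
    field
      positive   : ∀ i → i ≤ d → 0# < b i
      degree     : Degree≤ d b
      logConcave : ∀ i → b i * b (2 ℕ.+ i) ≤ᵣ b (1 ℕ.+ i) * b (1 ℕ.+ i)

  open PositiveLogConcave

  nonNeg : ∀ {b d} → PositiveLogConcave b d → ∀ i → NonNeg (b i)
  nonNeg {d = d} lc i with i ℕ.≤? d
  ... | yes i≤d = inj₁ (positive lc i i≤d)
  ... | no  i≰d = inj₂ (≈-sym (degree lc i (ℕₚ.≰⇒> i≰d)))

  one-positiveLogConcave : PositiveLogConcave one 0
  one-positiveLogConcave = record
    { positive   = λ { zero _ → 0<1 }
    ; degree     = λ { (suc i) _ → ≈-refl }
    ; logConcave = λ { zero → ≈0⇒≤ᵣ (zeroʳ 1#) (nonNeg-square 0#) ; (suc i) → ≤ᵣ-refl _ }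
    }

  -- b_j b_{j+3} ≤ b_{j+1} b_{j+2}: multiply the log-concavity at j and j + 1 and cancel b_{j+1} b_{j+2} > 0.
  cross : ∀ {b d} → PositiveLogConcave b d → ∀ j → b j * b (3 ℕ.+ j) ≤ᵣ b (1 ℕ.+ j) * b (2 ℕ.+ j)
  cross {b} {d} lc j with 2 ℕ.+ j ℕ.≤? d
  ... | no  j+2≰d = ≈0⇒≤ᵣ (≈-trans (*-congˡ (degree lc (3 ℕ.+ j) (ℕₚ.m<n⇒m<1+n (ℕₚ.≰⇒> j+2≰d)))) (zeroʳ _))
                          (nonNeg-* (nonNeg lc (1 ℕ.+ j)) (nonNeg lc (2 ℕ.+ j)))
  ... | yes j+2≤d = *-cancelˡ-≤ᵣ 0<w (≤ᵣ-resp (swap x₀ x₁ x₂ x₃) (square x₁ x₂)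
        (*-mono-≤ᵣ (nonNeg-* (nonNeg lc j) (nonNeg lc (2 ℕ.+ j)))
                   (nonNeg-* (nonNeg lc (1 ℕ.+ j)) (nonNeg lc (3 ℕ.+ j)))
                   (logConcave lc j) (logConcave lc (1 ℕ.+ j))))
    where
    x₀ = b j
    x₁ = b (1 ℕ.+ j)
    x₂ = b (2 ℕ.+ j)
    x₃ = b (3 ℕ.+ j)
    0<w : 0# < x₁ * x₂
    0<w = *-pos (positive lc (1 ℕ.+ j) (ℕₚ.≤-trans (ℕₚ.n≤1+n _) j+2≤d)) (positive lc (2 ℕ.+ j) j+2≤d)
    swap : ∀ x₀ x₁ x₂ x₃ → (x₀ * x₂) * (x₁ * x₃) ≈ (x₁ * x₂) * (x₀ * x₃)
    swap = solve 4 (λ x₀ x₁ x₂ x₃ → (x₀ :* x₂) :* (x₁ :* x₃) := (x₁ :* x₂) :* (x₀ :* x₃)) ≈-refl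
    square : ∀ x₁ x₂ → (x₁ * x₁) * (x₂ * x₂) ≈ (x₁ * x₂) * (x₁ * x₂)
    square = solve 2 (λ x₁ x₂ → (x₁ :* x₁) :* (x₂ :* x₂) := (x₁ :* x₂) :* (x₁ :* x₂)) ≈-refl

  linear-logConcave : ∀ {a x₀ x₁ x₂ x₃} → NonNeg a →
    x₀ * x₂ ≤ᵣ x₁ * x₁ → x₀ * x₃ ≤ᵣ x₁ * x₂ → x₁ * x₃ ≤ᵣ x₂ * x₂ →
    (x₀ + a * x₁) * (x₂ + a * x₃) ≤ᵣ (x₁ + a * x₂) * (x₁ + a * x₂)
  linear-logConcave {a} {x₀} {x₁} {x₂} {x₃} a≥0 (d₁ , d₁≥0 , e₁) (d₃ , d₃≥0 , e₃) (d₂ , d₂≥0 , e₂) =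
    d₁ + a * d₃ + a * a * d₂ ,
    nonNeg-+ (nonNeg-+ d₁≥0 (nonNeg-* a≥0 d₃≥0)) (nonNeg-* (nonNeg-* a≥0 a≥0) d₂≥0) ,
    (begin
      (x₁ + a * x₂) * (x₁ + a * x₂)
        ≈⟨ expand a x₁ x₂ ⟩
      x₁ * x₁ + a * (x₁ * x₂) + a * (x₁ * x₂) + a * a * (x₂ * x₂)
        ≈⟨ +-cong (+-cong (+-congʳ e₁) (*-congˡ e₃)) (*-congˡ e₂) ⟩
      (x₀ * x₂ + d₁) + a * (x₁ * x₂) + a * (x₀ * x₃ + d₃) + a * a * (x₁ * x₃ + d₂)
        ≈⟨ regroup a x₀ x₁ x₂ x₃ d₁ d₂ d₃ ⟩
      (x₀ + a * x₁) * (x₂ + a * x₃) + (d₁ + a * d₃ + a * a * d₂) ∎)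
    where
    open ≈-Reasoning
    expand : ∀ a y z → (y + a * z) * (y + a * z) ≈ y * y + a * (y * z) + a * (y * z) + a * a * (z * z)
    expand = solve 3 (λ a y z →
      (y :+ a :* z) :* (y :+ a :* z) := y :* y :+ a :* (y :* z) :+ a :* (y :* z) :+ a :* a :* (z :* z)) ≈-refl
    regroup : ∀ a w y z u d₁ d₂ d₃ →
      (w * z + d₁) + a * (y * z) + a * (w * u + d₃) + a * a * (y * u + d₂) ≈
      (w + a * y) * (z + a * u) + (d₁ + a * d₃ + a * a * d₂)
    regroup = solve 8 (λ a w y z u d₁ d₂ d₃ →
      (w :* z :+ d₁) :+ a :* (y :* z) :+ a :* (w :* u :+ d₃) :+ a :* a :* (y :* u :+ d₂) :=
      (w :+ a :* y) :* (z :+ a :* u) :+ (d₁ :+ a :* d₃ :+ a :* a :* d₂)) ≈-refl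

  -- (x + a) b has coefficients sᵢ + a sᵢ₊₁ for s = shift b, and s inherits log-concavity from b.
  linear-positiveLogConcave : ∀ {b d a} → PositiveLogConcave b d → 0# < a → PositiveLogConcave (linear a b) (suc d)
  linear-positiveLogConcave {b} {d} {a} lc 0<a = record
    { positive   = λ { zero _ → <-respʳ-≈ (≈-sym (+-identityˡ _)) (*-pos 0<a (positive lc 0 z≤n))
                     ; (suc i) (s≤s i≤d) → pos+nonNeg (positive lc i i≤d) (nonNeg-* (inj₁ 0<a) (nonNeg lc (suc i))) }
    ; degree     = λ { (suc i) (s≤s d<i) → ≈-trans (+-cong (degree lc i d<i)
                        (≈-trans (*-congˡ (degree lc (suc i) (ℕₚ.m<n⇒m<1+n d<i))) (zeroʳ a))) (+-identityˡ 0#) }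
    ; logConcave = λ i → linear-logConcave (inj₁ 0<a) (shifted-logConcave i) (shifted-cross i) (shifted-logConcave (suc i))
    }
    where
    shifted-logConcave : ∀ i → shift b i * shift b (2 ℕ.+ i) ≤ᵣ shift b (1 ℕ.+ i) * shift b (1 ℕ.+ i)
    shifted-logConcave zero    = ≈0⇒≤ᵣ (zeroˡ _) (nonNeg-square (b 0))
    shifted-logConcave (suc i) = logConcave lc i
    shifted-cross : ∀ i → shift b i * shift b (3 ℕ.+ i) ≤ᵣ shift b (1 ℕ.+ i) * shift b (2 ℕ.+ i)
    shifted-cross zero    = ≈0⇒≤ᵣ (zeroˡ _) (nonNeg-* (nonNeg lc 0) (nonNeg lc 1))
    shifted-cross (suc i) = cross lc i

  prodLinear-positiveLogConcave : ∀ {as} → All (0# <_) as → PositiveLogConcave (prodLinear as) (length as)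
  prodLinear-positiveLogConcave []           = one-positiveLogConcave
  prodLinear-positiveLogConcave (0<a ∷ 0<as) = linear-positiveLogConcave (prodLinear-positiveLogConcave 0<as) 0<a

  realRooted⇒unimodal : ∀ (a : ℕ → ℕ) → a 0 ≡.≡ 1 → RealRooted R a → Unimodal a
  realRooted⇒unimodal a a₀≡1 (lc , rs , lc≉0 , a≈) =
    logConcave⇒unimodal a logConcaveℕ zero-persists (length as) (a≡0-beyond (suc (length as)) ℕₚ.≤-refl)
    where
    as = List.map -_ rs
    b = prodLinear as
    b-plc = prodLinear-positiveLogConcave (negatedRoots-pos a lc rs a≈ a₀≡1)
    a≈lc·b : ∀ i → fromℕ (a i) ≈ lc * b i
    a≈lc·b i = ≈-trans (a≈ i) (*-congˡ (coeff-prodLin rs i))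
    a≡0-beyond : ∀ i → length as ℕ.< i → a i ≡.≡ 0
    a≡0-beyond i d<i = fromℕ≈0⇒≡0 (≈-trans (a≈lc·b i) (≈-trans (*-congˡ (degree b-plc i d<i)) (zeroʳ lc)))
    a≡0⇒beyond : ∀ i → a i ≡.≡ 0 → length as ℕ.< i
    a≡0⇒beyond i aᵢ≡0 with i ℕ.≤? length as
    ... | no  i≰d = ℕₚ.≰⇒> i≰d
    ... | yes i≤d = ⊥-elim (nonzero-* lc≉0 (pos⇒nonzero (positive b-plc i i≤d))
                                      (≈-trans (≈-sym (a≈lc·b i)) (reflexive (≡.cong fromℕ aᵢ≡0))))
    zero-persists : ∀ i → a (1 ℕ.+ i) ≡.≡ 0 → a (2 ℕ.+ i) ≡.≡ 0
    zero-persists i aᵢ₊₁≡0 = a≡0-beyond (2 ℕ.+ i) (ℕₚ.m<n⇒m<1+n (a≡0⇒beyond (1 ℕ.+ i) aᵢ₊₁≡0))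
    fromℕ-product : ∀ u v → fromℕ (a u ℕ.* a v) ≈ (lc * lc) * (b u * b v)
    fromℕ-product u v = ≈-trans (fromℕ-* (a u) (a v)) (≈-trans (*-cong (a≈lc·b u) (a≈lc·b v)) (regroup lc (b u) (b v)))
      where
      regroup : ∀ l x y → (l * x) * (l * y) ≈ (l * l) * (x * y)
      regroup = solve 3 (λ l x y → (l :* x) :* (l :* y) := (l :* l) :* (x :* y)) ≈-refl
    logConcaveℕ : ∀ i → a i ℕ.* a (2 ℕ.+ i) ≤ a (1 ℕ.+ i) ℕ.* a (1 ℕ.+ i)
    logConcaveℕ i = fromℕ-cancel-≤
      (≤ᵣ-resp (≈-sym (fromℕ-product i (2 ℕ.+ i))) (≈-sym (fromℕ-product (1 ℕ.+ i) (1 ℕ.+ i)))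
               (*-mono-≤ᵣ (nonNeg-square lc) (nonNeg-* (nonNeg b-plc i) (nonNeg b-plc (2 ℕ.+ i)))
                          (≤ᵣ-refl (lc * lc)) (logConcave b-plc i)))

open IndependentSets using (indepCoeff-zero; module Corona)
open CoronaRealRooted using (realRooted-corona)
open LogConcavity using (realRooted⇒unimodal)

coronaSize-nonempty : ∀ p n j → 1 ≤ n → 1 ≤ coronaSize p n j
coronaSize-nonempty p n zero    1≤n = 1≤n
coronaSize-nonempty p n (suc j) 1≤n = ℕₚ.≤-trans (coronaSize-nonempty p n j 1≤n) (ℕₚ.m≤m+n _ _)
  where import Data.Nat.Properties as ℕₚ

mainTheorem6 : {c ℓ : Level} (R : RealClosedField c ℓ) {n : ℕ} (H : Graph n) →
    IsSimpleGraph H → RealRooted R (indepCoeff H) →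
    (p : ℕ) → 2 ≤ p → (j : ℕ) →
      OneWellCovered (coronaIter p (suc j) H)
      × RealRooted R (indepCoeff (coronaIter p (suc j) H))
      × Unimodal (indepCoeff (coronaIter p (suc j) H))
mainTheorem6 R {n} H simple H-realRooted p 2≤p@(s≤s _) j =
    Corona.corona-oneWellCovered p (coronaIter p j H)
      (coronaSize-nonempty p n j (IsSimpleGraph.nonempty simple)) 2≤p
  , realRooted (suc j)
  , realRooted⇒unimodal R _ (indepCoeff-zero (coronaIter p (suc j) H)) (realRooted (suc j))
  where
  realRooted : ∀ j → RealRooted R (indepCoeff (coronaIter p j H))
  realRooted zero    = H-realRooted
  realRooted (suc j) = realRooted-corona R p (s≤s z≤n) (coronaIter p j H) (realRooted j)
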